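{- Let $t\ge2$, $n\ge1$, let $\lambda$ be a partition with $\ell(\lambda)\le tn$, write $n_i=n_i(\lambda,tn)$, and let $\kappa$ be the $t$-core of $\lambda$. (1) If $\kappa$ is a symplectic $t$-core, then $\mathrm{rk}(\kappa)=\sum_{i=0}^{\lfloor (t-3)/2\rfloor}|n_i-n|=\sum_{i=\lfloor (t-1)/2\rfloor}^{t-2}|n_i-n|$. (2) If $\kappa$ is an orthogonal $t$-core, then $\mathrm{rk}(\kappa)=\sum_{i=1}^{\lfloor (t-1)/2\rfloor}|n_i-n|$. (3) If $\kappa$ is a self-conjugate $t$-core, then $\mathrm{rk}(\kappa)=\sum_{i=0}^{\lfloor (t-2)/2\rfloor}|n_i-n|$.
   Context: $\mathrm{rk}$ denotes the rank (largest $k$ with $\kappa_k\ge k$). For $\ell(\lambda)\le m$, $\beta(\lambda,m)=(\lambda_j+m-j)_{j=1}^m$ and $n_i(\lambda,m)$ is the number of its entries congruent to $i$ mod $t$. The $t$-core is obtained by successively removing border strips of size $t$. With Frobenius coordinates $\alpha_i=\kappa_i-i$, $\beta_i=\kappa'_i-i$ ($1\le i\le\mathrm{rk}(\kappa)$, $\kappa'$ the conjugate): $\kappa$ is symplectic if $\beta_i=\alpha_i+1$ for all $i$, orthogonal if $\beta_i=\alpha_i-1$ for all $i$ (empty partition is both); symplectic/orthogonal $t$-cores are such partitions that are $t$-cores; self-conjugate means $\kappa=\kappa'$. -}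

module Defs where

open import Data.Nat using (ℕ; zero; suc; _+_; _*_; _∸_; _≤_; _<_; _<?_; _≤?_; ∣_-_∣)
open import Data.Nat.DivMod using (_%_)
open import Data.List using (List; []; _∷_; length; filter)
open import Data.List.Relation.Unary.All using (All)
open import Data.List.Relation.Unary.Linked using (Linked)
open import Data.Product using (_×_; ∃; Σ)
open import Relation.Binary.PropositionalEquality using (_≡_)
open import Relation.Binary.Construct.Closure.ReflexiveTransitive using (Star)
open import Relation.Nullary using (¬_)
open import Data.Nat using (_≟_)

record Partition : Set where
  constructor mkPartition
  field
    parts    : List ℕ
    positive : All (0 <_) parts
    decr     : Linked (λ a b → b ≤ a) parts
open Partition public

ℓ : Partition → ℕ
ℓ p = length (parts p)

-- i-th part, 0-indexed (part λ i = λ_{i+1}); 0 beyond the length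
nth : List ℕ → ℕ → ℕ
nth []       _       = 0
nth (a ∷ as) zero    = a
nth (a ∷ as) (suc i) = nth as i

part : Partition → ℕ → ℕ
part p i = nth (parts p) i

-- conjugate partition, 0-indexed: conjPart κ j = κ'_{j+1} = #{ i : κ_i > j }
conjPart : Partition → ℕ → ℕ
conjPart p j = length (filter (j <?_) (parts p))

-- rank: largest k with κ_k ≥ k (1-indexed)
rkFrom : ℕ → List ℕ → ℕ
rkFrom i []       = 0
rkFrom i (a ∷ as) with i <? a
... | Relation.Nullary.yes _ = suc (rkFrom (suc i) as)
... | Relation.Nullary.no  _ = 0

rk : Partition → ℕ
rk p = rkFrom 0 (parts p)

-- Frobenius coordinates, indexed by k = i - 1 (so i = k + 1, 1 ≤ i ≤ rk)
frobα : Partition → ℕ → ℕ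
frobα p k = part p k ∸ suc k

frobβ : Partition → ℕ → ℕ
frobβ p k = conjPart p k ∸ suc k

Symplectic : Partition → Set
Symplectic p = ∀ k → k < rk p → frobβ p k ≡ frobα p k + 1

Orthogonal : Partition → Set
Orthogonal p = ∀ k → k < rk p → frobα p k ≡ frobβ p k + 1

SelfConjugate : Partition → Set
SelfConjugate p = ∀ j → conjPart p j ≡ part p j

-- Border strips (rim hooks). Cells (i , j) are 0-indexed: (i , j) ∈ λ iff j < λ_{i+1}.

SkewCell : Partition → Partition → ℕ → ℕ → Set
SkewCell la mu i j = (part mu i ≤ j) × (j < part la i)

data Adj : ℕ → ℕ → ℕ → ℕ → Set where
  down  : ∀ i j → Adj i j (suc i) j
  up    : ∀ i j → Adj (suc i) j i j
  right : ∀ i j → Adj i j i (suc j)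
  left  : ∀ i j → Adj i (suc j) i j

data SkewPath (la mu : Partition) : ℕ → ℕ → ℕ → ℕ → Set where
  here : ∀ {i j} → SkewPath la mu i j i j
  step : ∀ {i j i₁ j₁ i' j'} → Adj i j i₁ j₁ → SkewCell la mu i₁ j₁ →
         SkewPath la mu i₁ j₁ i' j' → SkewPath la mu i j i' j'

sumRange : ℕ → ℕ → (ℕ → ℕ) → ℕ
sumRange a zero    f = 0
sumRange a (suc b) f with a ≤? b
... | Relation.Nullary.yes _ = sumRange a b f + f b
... | Relation.Nullary.no  _ = 0

RemovesStrip : ℕ → Partition → Partition → Set
RemovesStrip t la mu =
  (∀ i → part mu i ≤ part la i) ×
  (sumRange 0 (ℓ la) (λ i → part la i ∸ part mu i) ≡ t) ×
  (∀ i j → ¬ (SkewCell la mu i j × SkewCell la mu (suc i) j ×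
              SkewCell la mu i (suc j) × SkewCell la mu (suc i) (suc j))) ×
  (∀ i j i' j' → SkewCell la mu i j → SkewCell la mu i' j' → SkewPath la mu i j i' j')

IsTCoreOf : ℕ → Partition → Partition → Set
IsTCoreOf t la ka = Star (RemovesStrip t) la ka × (¬ ∃ λ mu → RemovesStrip t ka mu)

-- β(λ, m) = (λ_j + m - j)_{j=1..m};  nCount t λ m i = n_i(λ, m)
-- = #{ 1 ≤ j ≤ m : (λ_j + m - j) ≡ i mod t }
betaEntry : Partition → ℕ → ℕ → ℕ   -- j 0-indexed: λ_{j+1} + m - (j+1)
betaEntry p m j = part p j + (m ∸ suc j)

nCount : (t : ℕ) → .{{_ : Data.Nat.NonZero t}} → Partition → ℕ → ℕ → ℕ
nCount t p m i = sumRange 0 m (λ j → indicator (betaEntry p m j % t) )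
  where
  indicator : ℕ → ℕ
  indicator r with r ≟ i
  ... | Relation.Nullary.yes _ = 1
  ... | Relation.Nullary.no  _ = 0

{-# OPTIONS --safe #-}
-- Place the β-numbers β(κ, tn) of a partition κ on a t-runner abacus.  The first rk κ of them are
-- tn + α_k, and the positions below tn carrying no bead are exactly γ_k = tn − 1 − β_k for the
-- Frobenius coordinates β_k (k < rk κ), so counting residues mod t gives
-- n_i + #{k : γ_k ≡ i} = n + #{k : α_k ≡ i}.  Removing a t-rim hook slides one bead t places down its
-- runner, hence n_i(λ) = n_i(κ).  The runners of a t-core are flush, so no residue is hit both by an
-- α_k and by a γ_k, and |n_i − n| = #{k : α_k ≡ i} + #{k : γ_k ≡ i}.  Finally α_k + γ_k = tn − 2,
-- tn − 1, tn for symplectic, self-conjugate and orthogonal κ, so the residues of α_k and γ_k are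
-- distinct and add up to t − 2, t − 1, t: exactly one of them lies in each of the stated ranges, and
-- summing over k gives rk κ.
module Submission where

open import Defs
open import Data.Bool using (true; false; T)
open import Data.Empty using (⊥; ⊥-elim)
open import Data.List using (List; []; _∷_; length; filter)
import Data.List
open import Data.List.Properties using (length-filter)
open import Data.List.Relation.Unary.All using (All; []; _∷_)
open import Data.List.Relation.Unary.Linked using (Linked; []; _∷_; _∷′_) renaming (tail to Linked-tail)
import Data.Maybe
open import Data.Maybe.Relation.Binary.Connected using (Connected; just; just-nothing)
open import Data.Nat
open import Data.Nat.DivMod
open import Data.Nat.Properties
open import Algebra.Properties.CommutativeSemigroup +-commutativeSemigroup
  using () renaming (interchange to +-interchange)
open import Data.Nat.Solver using (module +-*-Solver)
open +-*-Solver using (solve; _:+_; _:*_; _:=_; con)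
open import Data.Product
open import Data.Sum using (_⊎_; inj₁; inj₂)
open import Data.Unit using (tt)
open import Function using (_∘_)
open import Relation.Binary.Construct.Closure.ReflexiveTransitive using (Star; ε; _◅_)
open import Relation.Binary.Definitions using (tri<; tri≈; tri>)
open import Relation.Binary.PropositionalEquality
open import Relation.Nullary
open import Relation.Nullary.Decidable using (_×-dec_)

-- Finite sums

ExactlyOne : Set → Set → Set
ExactlyOne A B = (A × ¬ B) ⊎ (¬ A × B)

infix 4 _∈[_,_⟩
_∈[_,_⟩ : ℕ → ℕ → ℕ → Set
x ∈[ lo , hi ⟩ = lo ≤ x × x < hi

χ : {P : Set} → Dec P → ℕ
χ (yes _) = 1
χ (no _)  = 0

χ-yes : {P : Set} (d : Dec P) → P → χ d ≡ 1
χ-yes (yes _) p  = refl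
χ-yes (no ¬p) p  = ⊥-elim (¬p p)

χ-no : {P : Set} (d : Dec P) → ¬ P → χ d ≡ 0
χ-no (yes p) ¬p = ⊥-elim (¬p p)
χ-no (no _)  ¬p = refl

χ-pos : {P : Set} (d : Dec P) → 0 < χ d → P
χ-pos (yes p) _ = p

δ : ℕ → ℕ → ℕ
δ x y = χ (x ≟ y)

sumTo : ℕ → (ℕ → ℕ) → ℕ
sumTo n f = sumRange 0 n f

sumRange-suc : ∀ {a b} (f : ℕ → ℕ) → a ≤ b → sumRange a (suc b) f ≡ sumRange a b f + f b
sumRange-suc {a} {b} f a≤b with a ≤? b
... | yes _  = refl
... | no a≰b = ⊥-elim (a≰b a≤b)

sumRange-suc-empty : ∀ {a b} (f : ℕ → ℕ) → ¬ a ≤ b → sumRange a (suc b) f ≡ 0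
sumRange-suc-empty {a} {b} f a≰b with a ≤? b
... | yes a≤b = ⊥-elim (a≰b a≤b)
... | no _    = refl

sumRange-empty : ∀ a b (f : ℕ → ℕ) → b ≤ a → sumRange a b f ≡ 0
sumRange-empty a zero    f _   = refl
sumRange-empty a (suc b) f b<a = sumRange-suc-empty f (<⇒≱ b<a)

sumRange-cong : ∀ a b {f g : ℕ → ℕ} → (∀ i → a ≤ i → i < b → f i ≡ g i) →
                sumRange a b f ≡ sumRange a b g
sumRange-cong a zero    f≗g = refl
sumRange-cong a (suc b) f≗g with a ≤? b
... | yes a≤b = cong₂ _+_ (sumRange-cong a b (λ i a≤i i<b → f≗g i a≤i (m<n⇒m<1+n i<b)))
                          (f≗g b a≤b ≤-refl)
... | no _    = refl

sumRange-zeros : ∀ a b {f : ℕ → ℕ} → (∀ i → a ≤ i → i < b → f i ≡ 0) → sumRange a b f ≡ 0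
sumRange-zeros a b f≗0 = trans (sumRange-cong a b f≗0) (sumRange-zeros′ b)
  where
  sumRange-zeros′ : ∀ b → sumRange a b (λ _ → 0) ≡ 0
  sumRange-zeros′ zero = refl
  sumRange-zeros′ (suc b) with a ≤? b
  ... | yes _ = cong (_+ 0) (sumRange-zeros′ b)
  ... | no _  = refl

sumRange-+ : ∀ a b (f g : ℕ → ℕ) →
             sumRange a b (λ i → f i + g i) ≡ sumRange a b f + sumRange a b g
sumRange-+ a zero    f g = refl
sumRange-+ a (suc b) f g with a ≤? b
... | yes _ = trans (cong (_+ (f b + g b)) (sumRange-+ a b f g))
                    (+-interchange (sumRange a b f) (sumRange a b g) (f b) (g b))
... | no _  = refl

sumRange-swap : ∀ a b c d (h : ℕ → ℕ → ℕ) →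
                sumRange a b (λ i → sumRange c d (h i)) ≡ sumRange c d (λ k → sumRange a b (λ i → h i k))
sumRange-swap a zero    c d h = sym (sumRange-zeros c d (λ _ _ _ → refl))
sumRange-swap a (suc b) c d h = go (a ≤? b)
  where
  open ≡-Reasoning
  go : Dec (a ≤ b) →
       sumRange a (suc b) (λ i → sumRange c d (h i)) ≡ sumRange c d (λ k → sumRange a (suc b) (λ i → h i k))
  go (yes a≤b) = begin
    sumRange a (suc b) (λ i → sumRange c d (h i))
      ≡⟨ sumRange-suc _ a≤b ⟩
    sumRange a b (λ i → sumRange c d (h i)) + sumRange c d (h b)
      ≡⟨ cong (_+ sumRange c d (h b)) (sumRange-swap a b c d h) ⟩
    sumRange c d (λ k → sumRange a b (λ i → h i k)) + sumRange c d (h b)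
      ≡⟨ sumRange-+ c d _ (h b) ⟨
    sumRange c d (λ k → sumRange a b (λ i → h i k) + h b k)
      ≡⟨ sumRange-cong c d (λ k _ _ → sumRange-suc (λ i → h i k) a≤b) ⟨
    sumRange c d (λ k → sumRange a (suc b) (λ i → h i k)) ∎
  go (no a≰b) = trans (sumRange-suc-empty _ a≰b)
                      (sym (sumRange-zeros c d (λ k _ _ → sumRange-suc-empty (λ i → h i k) a≰b)))

sumRange-split : ∀ a b c (f : ℕ → ℕ) → a ≤ b → b ≤ c →
                 sumRange a c f ≡ sumRange a b f + sumRange b c f
sumRange-split a .zero zero f _ z≤n = sym (+-identityʳ (sumRange a 0 f))
sumRange-split a b (suc c) f a≤b b≤1+c with m≤n⇒m<n∨m≡n b≤1+c
... | inj₂ refl = sym (trans (cong (sumRange a (suc c) f +_) (sumRange-empty (suc c) (suc c) f ≤-refl))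
                             (+-identityʳ _))
... | inj₁ b<1+c = begin
  sumRange a (suc c) f                     ≡⟨ sumRange-suc f (≤-trans a≤b b≤c) ⟩
  sumRange a c f + f c                     ≡⟨ cong (_+ f c) (sumRange-split a b c f a≤b b≤c) ⟩
  sumRange a b f + sumRange b c f + f c    ≡⟨ +-assoc (sumRange a b f) _ _ ⟩
  sumRange a b f + (sumRange b c f + f c)  ≡⟨ cong (sumRange a b f +_) (sumRange-suc f b≤c) ⟨
  sumRange a b f + sumRange b (suc c) f    ∎
  where
  open ≡-Reasoning
  b≤c : b ≤ c
  b≤c = ≤-pred b<1+c

sumRange-shift : ∀ a d (f : ℕ → ℕ) → sumRange a (a + d) f ≡ sumTo d (λ k → f (a + k))
sumRange-shift a zero    f = trans (cong (λ x → sumRange a x f) (+-identityʳ a))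
                                   (sumRange-empty a a f ≤-refl)
sumRange-shift a (suc d) f = trans (cong (λ x → sumRange a x f) (+-suc a d))
  (trans (sumRange-suc f (m≤m+n a d)) (cong (_+ f (a + d)) (sumRange-shift a d f)))

sumRange-cons : ∀ a b (f : ℕ → ℕ) → a < b → sumRange a b f ≡ f a + sumRange (suc a) b f
sumRange-cons a b f a<b = trans (sumRange-split a (suc a) b f (n≤1+n a) a<b)
  (cong (_+ sumRange (suc a) b f)
        (trans (sumRange-suc f ≤-refl) (cong (_+ f a) (sumRange-empty a a f ≤-refl))))

sumTo-cons : ∀ n (f : ℕ → ℕ) → sumTo (suc n) f ≡ f 0 + sumTo n (λ k → f (suc k))
sumTo-cons n f = trans (sumRange-cons 0 (suc n) f z<s) (cong (f 0 +_) (sumRange-shift 1 n f))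

sumTo-split : ∀ a b (f : ℕ → ℕ) → sumTo (a + b) f ≡ sumTo a f + sumTo b (λ k → f (a + k))
sumTo-split a b f = trans (sumRange-split 0 a (a + b) f z≤n (m≤m+n a b))
                          (cong (sumTo a f +_) (sumRange-shift a b f))

sumTo-around : ∀ N a w (f : ℕ → ℕ) → a + w ≤ N →
               sumTo N f ≡ sumTo a f + (sumTo w (λ k → f (a + k)) + sumRange (a + w) N f)
sumTo-around N a w f a+w≤N =
  trans (sumRange-split 0 a N f z≤n (≤-trans (m≤m+n a w) a+w≤N))
        (cong (sumTo a f +_) (trans (sumRange-split a (a + w) N f (m≤m+n a w) a+w≤N)
                                    (cong (_+ sumRange (a + w) N f) (sumRange-shift a w f))))

sumTo-window : ∀ N a w (f : ℕ → ℕ) → a + w ≤ N → (∀ i → i < a ⊎ a + w ≤ i → f i ≡ 0) →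
               sumTo N f ≡ sumTo w (λ k → f (a + k))
sumTo-window N a w f a+w≤N outside≡0 = begin
  sumTo N f                                         ≡⟨ sumTo-around N a w f a+w≤N ⟩
  sumTo a f + (window + sumRange (a + w) N f)       ≡⟨ cong₂ (λ x y → x + (window + y)) before after ⟩
  window + 0                                        ≡⟨ +-identityʳ window ⟩
  window                                            ∎
  where
  open ≡-Reasoning
  window : ℕ
  window = sumTo w (λ k → f (a + k))
  before : sumTo a f ≡ 0
  before = sumRange-zeros 0 a (λ i _ i<a → outside≡0 i (inj₁ i<a))
  after : sumRange (a + w) N f ≡ 0
  after = sumRange-zeros (a + w) N (λ i past _ → outside≡0 i (inj₂ past))

sumTo-ones : ∀ n → sumTo n (λ _ → 1) ≡ n
sumTo-ones zero    = refl
sumTo-ones (suc n) = trans (cong (_+ 1) (sumTo-ones n)) (+-comm n 1)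

sumRange-*ʳ : ∀ a b (f : ℕ → ℕ) c → sumRange a b (λ i → f i * c) ≡ sumRange a b f * c
sumRange-*ʳ a zero    f c = refl
sumRange-*ʳ a (suc b) f c with a ≤? b
... | yes _ = trans (cong (_+ f b * c) (sumRange-*ʳ a b f c))
                    (sym (*-distribʳ-+ c (sumRange a b f) (f b)))
... | no _  = refl

sumRange-δ : ∀ a b c → a ≤ c → c < b → sumRange a b (δ c) ≡ 1
sumRange-δ a b c a≤c c<b = begin
  sumRange a b (δ c)                             ≡⟨ sumRange-split a c b _ a≤c (<⇒≤ c<b) ⟩
  sumRange a c (δ c) + sumRange c b (δ c)        ≡⟨ cong₂ _+_ below (sumRange-cons c b _ c<b) ⟩
  δ c c + sumRange (suc c) b (δ c)               ≡⟨ cong₂ _+_ (χ-yes (c ≟ c) refl) above ⟩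
  1                                              ∎
  where
  open ≡-Reasoning
  below : sumRange a c (δ c) ≡ 0
  below = sumRange-zeros a c (λ i _ i<c → χ-no (c ≟ i) (λ c≡i → <-irrefl (sym c≡i) i<c))
  above : sumRange (suc c) b (δ c) ≡ 0
  above = sumRange-zeros (suc c) b (λ i c<i _ → χ-no (c ≟ i) (λ c≡i → <-irrefl c≡i c<i))

sumRange-δ-outside : ∀ a b c → ¬ c ∈[ a , b ⟩ → sumRange a b (δ c) ≡ 0
sumRange-δ-outside a b c c∉ =
  sumRange-zeros a b (λ i a≤i i<b → χ-no (c ≟ i) (λ { refl → c∉ (a≤i , i<b) }))

sumRange-mono : ∀ a b {f g : ℕ → ℕ} → (∀ i → a ≤ i → i < b → f i ≤ g i) →
                sumRange a b f ≤ sumRange a b g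
sumRange-mono a zero    f≤g = z≤n
sumRange-mono a (suc b) f≤g with a ≤? b
... | yes a≤b = +-mono-≤ (sumRange-mono a b (λ i a≤i i<b → f≤g i a≤i (m<n⇒m<1+n i<b)))
                         (f≤g b a≤b ≤-refl)
... | no _    = z≤n

sumRange-positive : ∀ a b (f : ℕ → ℕ) → 0 < sumRange a b f → ∃ λ i → a ≤ i × i < b × 0 < f i
sumRange-positive a (suc b) f pos with a ≤? b
... | no _ = ⊥-elim (<-irrefl refl pos)
... | yes a≤b with f b in fb≡
...   | suc _ = b , a≤b , ≤-refl , subst (0 <_) (sym fb≡) z<s
...   | zero with sumRange-positive a b f (subst (0 <_) (+-identityʳ _) pos)
...     | i , a≤i , i<b , fi>0 = i , a≤i , m<n⇒m<1+n i<b , fi>0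

sumTo-forces-ones : ∀ n (f : ℕ → ℕ) → (∀ i → i < n → f i ≤ 1) → n ≤ sumTo n f →
                    ∀ i → i < n → f i ≡ 1
sumTo-forces-ones (suc n) f f≤1 n≤Σ i i<1+n with m≤n⇒m<n∨m≡n (≤-pred i<1+n)
... | inj₂ refl = ≤-antisym (f≤1 n ≤-refl)
                    (+-cancelˡ-≤ n 1 (f n) (≤-trans (≤-reflexive (+-comm n 1))
                                                    (≤-trans n≤Σ (+-monoˡ-≤ (f n) Σ≤n))))
  where
  Σ≤n : sumTo n f ≤ n
  Σ≤n = ≤-trans (sumRange-mono 0 n (λ i _ i<n → f≤1 i (m<n⇒m<1+n i<n))) (≤-reflexive (sumTo-ones n))
... | inj₁ i<n = sumTo-forces-ones n f (λ j j<n → f≤1 j (m<n⇒m<1+n j<n))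
                   (+-cancelʳ-≤ 1 n (sumTo n f) (≤-trans (≤-reflexive (+-comm n 1))
                                                (≤-trans n≤Σ (+-monoʳ-≤ (sumTo n f) (f≤1 n ≤-refl)))))
                   i i<n

δ-no : ∀ {x y} → x ≢ y → δ x y ≡ 0
δ-no {x} {y} = χ-no (x ≟ y)

δ-sym : ∀ x y → δ x y ≡ δ y x
δ-sym x y with x ≟ y | y ≟ x
... | yes _   | yes _   = refl
... | no _    | no _    = refl
... | yes x≡y | no y≢x  = ⊥-elim (y≢x (sym x≡y))
... | no x≢y  | yes y≡x = ⊥-elim (x≢y (sym y≡x))

δ-*-at : ∀ c x (g : ℕ → ℕ) → δ c x * g x ≡ δ c x * g c
δ-*-at c x g with c ≟ x
... | yes refl = refl
... | no _     = refl

sumTo-δ-* : ∀ M c (g : ℕ → ℕ) → c < M → sumTo M (λ x → δ c x * g x) ≡ g c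
sumTo-δ-* M c g c<M = begin
  sumTo M (λ x → δ c x * g x)  ≡⟨ sumRange-cong 0 M (λ x _ _ → δ-*-at c x g) ⟩
  sumTo M (λ x → δ c x * g c)  ≡⟨ sumRange-*ʳ 0 M (δ c) (g c) ⟩
  sumTo M (δ c) * g c          ≡⟨ cong (_* g c) (sumRange-δ 0 M c z≤n c<M) ⟩
  1 * g c                      ≡⟨ *-identityˡ (g c) ⟩
  g c                          ∎
  where open ≡-Reasoning

sumTo-reindex : ∀ n M (f g : ℕ → ℕ) → (∀ j → j < n → f j < M) →
                sumTo n (λ j → g (f j)) ≡ sumTo M (λ x → sumTo n (λ j → δ (f j) x) * g x)
sumTo-reindex n M f g f<M = sym (begin
  sumTo M (λ x → sumTo n (λ j → δ (f j) x) * g x)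
    ≡⟨ sumRange-cong 0 M (λ x _ _ → sumRange-*ʳ 0 n (λ j → δ (f j) x) (g x)) ⟨
  sumTo M (λ x → sumTo n (λ j → δ (f j) x * g x))
    ≡⟨ sumRange-swap 0 M 0 n (λ x j → δ (f j) x * g x) ⟩
  sumTo n (λ j → sumTo M (λ x → δ (f j) x * g x))
    ≡⟨ sumRange-cong 0 n (λ j _ j<n → sumTo-δ-* M (f j) g (f<M j j<n)) ⟩
  sumTo n (λ j → g (f j)) ∎)
  where open ≡-Reasoning

InjectiveBelow : ℕ → (ℕ → ℕ) → Set
InjectiveBelow n f = ∀ j j′ → j < n → j′ < n → f j ≡ f j′ → j ≡ j′

multiplicity≤1 : ∀ n (f : ℕ → ℕ) x → InjectiveBelow n f → sumTo n (λ j → δ (f j) x) ≤ 1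
multiplicity≤1 zero    f x inj = z≤n
multiplicity≤1 (suc n) f x inj with f n ≟ x
... | yes fn≡x = ≤-reflexive (cong (_+ 1) (sumRange-zeros 0 n (λ j _ j<n → δ-no (λ fj≡x →
                   <-irrefl (inj j n (m<n⇒m<1+n j<n) ≤-refl (trans fj≡x (sym fn≡x))) j<n))))
... | no _     = subst (_≤ 1) (sym (+-identityʳ _))
                   (multiplicity≤1 n f x (λ j j′ j<n j′<n → inj j j′ (m<n⇒m<1+n j<n) (m<n⇒m<1+n j′<n)))

StrictlyAntitoneBelow : ℕ → (ℕ → ℕ) → Set
StrictlyAntitoneBelow n f = ∀ j → suc j < n → f (suc j) < f j

strictlyAntitone⇒> : ∀ {n f} → StrictlyAntitoneBelow n f → ∀ j j′ → j < j′ → j′ < n → f j′ < f j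
strictlyAntitone⇒> f↓ j (suc j′) j<1+j′ 1+j′<n with m≤n⇒m<n∨m≡n (≤-pred j<1+j′)
... | inj₂ refl = f↓ j 1+j′<n
... | inj₁ j<j′ = <-trans (f↓ j′ 1+j′<n) (strictlyAntitone⇒> f↓ j j′ j<j′ (<-trans (n<1+n j′) 1+j′<n))

strictlyAntitone⇒injective : ∀ {n f} → StrictlyAntitoneBelow n f → InjectiveBelow n f
strictlyAntitone⇒injective f↓ j j′ j<n j′<n fj≡fj′ with <-cmp j j′
... | tri≈ _ j≡j′ _ = j≡j′
... | tri< j<j′ _ _ = ⊥-elim (<-irrefl (sym fj≡fj′) (strictlyAntitone⇒> f↓ j j′ j<j′ j′<n))
... | tri> _ _ j′<j = ⊥-elim (<-irrefl fj≡fj′ (strictlyAntitone⇒> f↓ j′ j j′<j j<n))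

sumTo-telescope : ∀ (L U : ℕ → ℕ) a d → (∀ i → U i ≤ L i) →
                  (∀ k → k < d → L (suc (a + k)) ≡ U (a + k) + 1) →
                  sumTo (suc d) (λ k → L (a + k) ∸ U (a + k)) + U (a + d) ≡ L a + d
sumTo-telescope L U a zero U≤L _ =
  trans (cong (λ i → L i ∸ U i + U i) (+-identityʳ a))
        (trans (m∸n+n≡m (U≤L a)) (sym (+-identityʳ (L a))))
sumTo-telescope L U a (suc d) U≤L linked = begin
  S + (L (a + suc d) ∸ U (a + suc d)) + U (a + suc d)    ≡⟨ +-assoc S _ _ ⟩
  S + (L (a + suc d) ∸ U (a + suc d) + U (a + suc d))    ≡⟨ cong (S +_) (m∸n+n≡m (U≤L (a + suc d))) ⟩
  S + L (a + suc d)                                      ≡⟨ cong (λ i → S + L i) (+-suc a d) ⟩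
  S + L (suc (a + d))                                    ≡⟨ cong (S +_) (linked d ≤-refl) ⟩
  S + (U (a + d) + 1)                                    ≡⟨ +-assoc S _ 1 ⟨
  S + U (a + d) + 1                                      ≡⟨ cong (_+ 1) telescoped ⟩
  L a + d + 1                                            ≡⟨ trans (+-assoc (L a) d 1) (cong (L a +_) (+-comm d 1)) ⟩
  L a + suc d                                            ∎
  where
  open ≡-Reasoning
  S : ℕ
  S = sumTo (suc d) (λ k → L (a + k) ∸ U (a + k))
  telescoped : S + U (a + d) ≡ L a + d
  telescoped = sumTo-telescope L U a d U≤L (λ k k<d → linked k (m<n⇒m<1+n k<d))

-- Arithmetic

∸-suc : ∀ m j → suc j ≤ m → m ∸ j ≡ suc (m ∸ suc j)
∸-suc (suc m) zero    _   = refl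
∸-suc (suc m) (suc j) j<m = ∸-suc m j (≤-pred j<m)

∸-suc-shift : ∀ m a d → suc (a + d) ≤ m → m ∸ suc a ≡ m ∸ suc (a + d) + d
∸-suc-shift m a d 1+a+d≤m = begin
  m ∸ suc a                             ≡⟨ cong (_∸ suc a) (m∸n+n≡m 1+a+d≤m) ⟨
  m ∸ suc (a + d) + suc (a + d) ∸ suc a
    ≡⟨ cong (_∸ suc a) (solve 3 (λ X A D → X :+ (con 1 :+ (A :+ D)) := X :+ D :+ (con 1 :+ A)) refl (m ∸ suc (a + d)) a d) ⟩
  m ∸ suc (a + d) + d + suc a ∸ suc a   ≡⟨ m+n∸n≡m (m ∸ suc (a + d) + d) (suc a) ⟩
  m ∸ suc (a + d) + d                   ∎
  where open ≡-Reasoning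

h*2≡h+h : ∀ h → h * 2 ≡ h + h
h*2≡h+h h = solve 1 (λ h → h :* con 2 := h :+ h) refl h

halving-bounds : ∀ u → u / 2 + u / 2 ≤ u × u ≤ suc (u / 2 + u / 2)
halving-bounds u with u % 2 | m%n<n u 2 | m≡m%n+[m/n]*n u 2
... | zero        | _            | u≡ = ≤-reflexive (sym (trans u≡ (h*2≡h+h (u / 2)))) ,
                                        ≤-trans (≤-reflexive (trans u≡ (h*2≡h+h (u / 2)))) (n≤1+n _)
... | suc zero    | _            | u≡ = ≤-trans (n≤1+n _) (≤-reflexive (sym (trans u≡ (cong suc (h*2≡h+h (u / 2)))))) ,
                                        ≤-reflexive (trans u≡ (cong suc (h*2≡h+h (u / 2))))
... | suc (suc _) | s≤s (s≤s ()) | _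

exactlyOneBelow : ∀ a g H → a ≢ g → a + g ≤ H + H → H + H ≤ suc (a + g) → ExactlyOne (a < H) (g < H)
exactlyOneBelow a g H a≢g lower upper with a <? H | g <? H
... | yes a<H | no g≮H  = inj₁ (a<H , g≮H)
... | no a≮H  | yes g<H = inj₂ (a≮H , g<H)
... | yes a<H | yes g<H = ⊥-elim (<-irrefl refl (begin-strict
  suc (a + g)        <⟨ s≤s (≤-reflexive (sym (+-suc a g))) ⟩
  suc a + suc g      ≤⟨ +-mono-≤ a<H g<H ⟩
  H + H              ≤⟨ upper ⟩
  suc (a + g)        ∎))
  where open ≤-Reasoning
... | no a≮H  | no g≮H  = ⊥-elim (a≢g (trans a≡H (sym g≡H)))
  where
  a≡H : a ≡ H
  a≡H = ≤-antisym (+-cancelʳ-≤ g a H (≤-trans lower (+-monoʳ-≤ H (≮⇒≥ g≮H)))) (≮⇒≥ a≮H)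
  g≡H : g ≡ H
  g≡H = ≤-antisym (+-cancelˡ-≤ a g H (≤-trans lower (+-monoˡ-≤ H (≮⇒≥ a≮H)))) (≮⇒≥ g≮H)

multiple-between : ∀ t .{{_ : NonZero t}} s → s % t ≡ 0 → 0 < s → s < t + t → s ≡ t
multiple-between t s s%t≡0 s>0 s<2t = by-quotient (s / t) s≡q*t
  where
  s≡q*t : s ≡ s / t * t
  s≡q*t = trans (m≡m%n+[m/n]*n s t) (cong (_+ s / t * t) s%t≡0)
  by-quotient : ∀ q → s ≡ q * t → s ≡ t
  by-quotient zero           s≡0 = ⊥-elim (<-irrefl (sym s≡0) s>0)
  by-quotient (suc zero)     s≡t = trans s≡t (+-identityʳ t)
  by-quotient (suc (suc q))  s≡  = ⊥-elim (<⇒≱ s<2t (≤-trans (+-monoʳ-≤ t (m≤m+n t (q * t))) (≤-reflexive (sym s≡))))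

distinct-residues-bound : ∀ t a g → a < t → g < t → a ≢ g → a + g + 3 ≤ t + t
distinct-residues-bound t a g a<t g<t a≢g with <-cmp a g
... | tri≈ _ a≡g _ = ⊥-elim (a≢g a≡g)
... | tri< a<g _ _ = ≤-trans (≤-reflexive (solve 2 (λ A G → A :+ G :+ con 3 := (con 2 :+ A) :+ (con 1 :+ G)) refl a g))
                             (+-mono-≤ (≤-trans (s≤s a<g) g<t) g<t)
... | tri> _ _ g<a = ≤-trans (≤-reflexive (solve 2 (λ A G → A :+ G :+ con 3 := (con 1 :+ A) :+ (con 2 :+ G)) refl a g))
                             (+-mono-≤ a<t (≤-trans (s≤s g<a) a<t))

residues-sum : ∀ t .{{_ : NonZero t}} n x y c → x + y + c ≡ t * n → c ≤ 2 → x % t ≢ y % t →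
               x % t + y % t + c ≡ t
residues-sum t n x y c x+y+c≡tn c≤2 a≢g = multiple-between t s s%t≡0 s>0 s<2t
  where
  a g s : ℕ
  a = x % t
  g = y % t
  s = a + g + c
  s+Qt : x + y + c ≡ s + (x / t + y / t) * t
  s+Qt = begin
    x + y + c                            ≡⟨ cong₂ (λ u v → u + v + c) (m≡m%n+[m/n]*n x t) (m≡m%n+[m/n]*n y t) ⟩
    (a + x / t * t) + (g + y / t * t) + c ≡⟨ solve 6 (λ A X G Y C T → A :+ X :* T :+ (G :+ Y :* T) :+ C
                                                                   := A :+ G :+ C :+ (X :+ Y) :* T)
                                                    refl a (x / t) g (y / t) c t ⟩
    s + (x / t + y / t) * t              ∎
    where open ≡-Reasoning
  s%t≡0 : s % t ≡ 0
  s%t≡0 = begin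
    s % t                                ≡⟨ [m+kn]%n≡m%n s (x / t + y / t) t ⟨
    (s + (x / t + y / t) * t) % t        ≡⟨ cong (_% t) (trans (sym s+Qt) (trans x+y+c≡tn (*-comm t n))) ⟩
    n * t % t                            ≡⟨ m*n%n≡0 n t ⟩
    0                                    ∎
    where open ≡-Reasoning
  s>0 : 0 < s
  s>0 = ≰⇒> (λ s≤0 → a≢g (trans (n≤0⇒n≡0 (≤-trans (≤-trans (m≤m+n a g) (m≤m+n (a + g) c)) s≤0))
                           (sym (n≤0⇒n≡0 (≤-trans (≤-trans (m≤n+m g a) (m≤m+n (a + g) c)) s≤0)))))
  s<2t : s < t + t
  s<2t = ≤-trans (≤-reflexive (sym (+-suc (a + g) c)))
         (≤-trans (+-monoʳ-≤ (a + g) (s≤s c≤2)) (distinct-residues-bound t a g (m%n<n x t) (m%n<n y t) a≢g))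

residue-count : ∀ t .{{_ : NonZero t}} n i → i < t → sumTo (t * n) (λ x → δ (x % t) i) ≡ n
residue-count t zero i i<t = cong (λ N → sumTo N (λ x → δ (x % t) i)) (*-zeroʳ t)
residue-count t (suc n) i i<t = begin
  sumTo (t * suc n) (λ x → δ (x % t) i)
    ≡⟨ cong (λ N → sumTo N (λ x → δ (x % t) i)) (*-suc t n) ⟩
  sumTo (t + t * n) (λ x → δ (x % t) i)                               ≡⟨ sumTo-split t (t * n) _ ⟩
  sumTo t (λ x → δ (x % t) i) + sumTo (t * n) (λ x → δ ((t + x) % t) i) ≡⟨ cong₂ _+_ firstBlock shiftedBlocks ⟩
  1 + n                                                               ∎
  where
  open ≡-Reasoning
  firstBlock : sumTo t (λ x → δ (x % t) i) ≡ 1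
  firstBlock = trans (sumRange-cong 0 t (λ x _ x<t → trans (cong (λ y → δ y i) (m<n⇒m%n≡m x<t)) (δ-sym x i)))
                     (sumRange-δ 0 t i z≤n i<t)
  shiftedBlocks : sumTo (t * n) (λ x → δ ((t + x) % t) i) ≡ n
  shiftedBlocks = trans (sumRange-cong 0 (t * n) (λ x _ _ → cong (λ y → δ y i)
                                                   (trans (cong (_% t) (+-comm t x)) ([m+n]%n≡m%n x t))))
                        (residue-count t n i i<t)

≡-mod⇒+multiple : ∀ t .{{_ : NonZero t}} x y → x % t ≡ y % t → x ≤ y → ∃ λ q → y ≡ x + q * t
≡-mod⇒+multiple t x y x≡y x≤y = q , (begin
  y                                  ≡⟨ m≡m%n+[m/n]*n y t ⟩
  y % t + y / t * t                  ≡⟨ cong₂ (λ a b → a + b * t) (sym x≡y) (sym (m+[n∸m]≡n (/-monoˡ-≤ t x≤y))) ⟩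
  x % t + (x / t + q) * t            ≡⟨ cong (x % t +_) (*-distribʳ-+ t (x / t) q) ⟩
  x % t + (x / t * t + q * t)        ≡⟨ +-assoc (x % t) _ _ ⟨
  x % t + x / t * t + q * t          ≡⟨ cong (_+ q * t) (m≡m%n+[m/n]*n x t) ⟨
  x + q * t                          ∎)
  where
  open ≡-Reasoning
  q : ℕ
  q = y / t ∸ x / t

-- Bounded search

∃<? : (P : ℕ → Set) → (∀ j → Dec (P j)) → ∀ N → Dec (∃ λ j → j < N × P j)
∃<? P P? zero = no (λ { (j , () , _) })
∃<? P P? (suc N) with P? N | ∃<? P P? N
... | yes pN | _                   = yes (N , ≤-refl , pN)
... | no _   | yes (j , j<N , pj) = yes (j , m<n⇒m<1+n j<N , pj)
... | no ¬pN | no ¬p<N            = no λ { (j , j<1+N , pj) → lastOrBelow (m≤n⇒m<n∨m≡n (≤-pred j<1+N)) pj }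
  where
  lastOrBelow : ∀ {j} → j < N ⊎ j ≡ N → ¬ P j
  lastOrBelow {j} (inj₁ j<N) pj = ¬p<N (j , j<N , pj)
  lastOrBelow (inj₂ refl) pN = ¬pN pN

least-witness : (P : ℕ → Set) → (∀ j → Dec (P j)) → ∀ i → P i →
                ∃ λ a → P a × a ≤ i × (∀ j → j < a → ¬ P j)
least-witness P P? i pi = search 0 i refl (λ j ())
  where
  search : ∀ a d → a + d ≡ i → (∀ j → j < a → ¬ P j) → ∃ λ a → P a × a ≤ i × (∀ j → j < a → ¬ P j)
  search a d a+d≡i none<a with P? a
  ... | yes pa = a , pa , subst (a ≤_) a+d≡i (m≤m+n a d) , none<a
  search a zero    a+d≡i none<a | no ¬pa = ⊥-elim (¬pa (subst P (trans (sym a+d≡i) (+-identityʳ a)) pi))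
  search a (suc d) a+d≡i none<a | no ¬pa = search (suc a) d (trans (sym (+-suc a d)) a+d≡i) none≤a
    where
    none≤a : ∀ j → j < suc a → ¬ P j
    none≤a j j<1+a with m≤n⇒m<n∨m≡n (≤-pred j<1+a)
    ... | inj₁ j<a  = none<a j j<a
    ... | inj₂ refl = ¬pa

greatest-witness : (P : ℕ → Set) → (∀ j → Dec (P j)) → ∀ B → (∀ j → B ≤ j → ¬ P j) → ∀ i → P i →
                   ∃ λ b → P b × i ≤ b × (∀ j → b < j → ¬ P j)
greatest-witness P P? zero    none≥B i pi = ⊥-elim (none≥B i z≤n pi)
greatest-witness P P? (suc B) none>B i pi with P? B
... | yes pB = B , pB , ≮⇒≥ (λ B<i → none>B i B<i pi) , none>B
... | no ¬pB = greatest-witness P P? B none≥B i pi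
  where
  none≥B : ∀ j → B ≤ j → ¬ P j
  none≥B j B≤j with m≤n⇒m<n∨m≡n B≤j
  ... | inj₁ B<j  = none>B j B<j
  ... | inj₂ refl = ¬pB

-- Partitions

Descending : List ℕ → Set
Descending = Linked (λ a b → b ≤ a)

Antitone : (ℕ → ℕ) → Set
Antitone f = ∀ i → f (suc i) ≤ f i

antitone⇒≤ : ∀ {f} → Antitone f → ∀ {i j} → i ≤ j → f j ≤ f i
antitone⇒≤ {f} f↓ {i} {j} i≤j with m≤n⇒m<n∨m≡n i≤j
... | inj₂ refl = ≤-refl
... | inj₁ i<j with j
...   | suc j′ = ≤-trans (f↓ j′) (antitone⇒≤ f↓ (≤-pred i<j))

nth-antitone : ∀ (l : List ℕ) → Descending l → Antitone (nth l)
nth-antitone []          _        i       = z≤n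
nth-antitone (a ∷ [])    _        i       = z≤n
nth-antitone (a ∷ b ∷ l) (b≤a ∷ _) zero    = b≤a
nth-antitone (a ∷ b ∷ l) (_ ∷ l↓)  (suc i) = nth-antitone (b ∷ l) l↓ i

nth-beyond : ∀ (l : List ℕ) i → length l ≤ i → nth l i ≡ 0
nth-beyond []      i       _   = refl
nth-beyond (a ∷ l) (suc i) l≤i = nth-beyond l i (≤-pred l≤i)

nth-positive : ∀ (l : List ℕ) → All (0 <_) l → ∀ i → i < length l → 0 < nth l i
nth-positive (a ∷ l) (a>0 ∷ _) zero    _   = a>0
nth-positive (a ∷ l) (_ ∷ l>0) (suc i) i<l = nth-positive l l>0 i (≤-pred i<l)

part-antitone : ∀ p → Antitone (part p)
part-antitone p = nth-antitone (parts p) (decr p)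

part-≤ : ∀ p {i j} → i ≤ j → part p j ≤ part p i
part-≤ p = antitone⇒≤ (part-antitone p)

part-beyond : ∀ p i → ℓ p ≤ i → part p i ≡ 0
part-beyond p = nth-beyond (parts p)

part-positive : ∀ p i → i < ℓ p → 0 < part p i
part-positive p = nth-positive (parts p) (positive p)

part-positive⇒<ℓ : ∀ p i → 0 < part p i → i < ℓ p
part-positive⇒<ℓ p i pi>0 with i <? ℓ p
... | yes i<ℓ = i<ℓ
... | no i≮ℓ  = ⊥-elim (<-irrefl (sym (part-beyond p i (≮⇒≥ i≮ℓ))) pi>0)

ℓ-mono : ∀ mu la → (∀ i → part mu i ≤ part la i) → ℓ mu ≤ ℓ la
ℓ-mono mu la mu⊆la with ℓ mu ≤? ℓ la
... | yes ℓ≤ℓ = ℓ≤ℓ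
... | no ℓ≰ℓ  = ⊥-elim (<-irrefl (sym (part-beyond la (ℓ la) ≤-refl))
                                 (≤-trans (part-positive mu (ℓ la) (≰⇒> ℓ≰ℓ)) (mu⊆la (ℓ la))))

rkFrom-< : ∀ i l k → k < rkFrom i l → i + k < nth l k
rkFrom-< i (a ∷ l) k k<rk with i <? a
rkFrom-< i (a ∷ l) zero    _    | yes i<a = subst (_< a) (sym (+-identityʳ i)) i<a
rkFrom-< i (a ∷ l) (suc k) k<rk | yes _   =
  subst (_< nth l k) (sym (+-suc i k)) (rkFrom-< (suc i) l k (≤-pred k<rk))

rkFrom-> : ∀ i l k → (∀ k′ → k′ ≤ k → i + k′ < nth l k′) → k < rkFrom i l
rkFrom-> i []      k above = ⊥-elim (<⇒≱ (above 0 z≤n) z≤n)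
rkFrom-> i (a ∷ l) k above with i <? a
rkFrom-> i (a ∷ l) zero    above | yes _ = z<s
rkFrom-> i (a ∷ l) (suc k) above | yes _ =
  s≤s (rkFrom-> (suc i) l k (λ k′ k′≤k → subst (_< nth l k′) (+-suc i k′) (above (suc k′) (s≤s k′≤k))))
... | no i≮a = ⊥-elim (i≮a (subst (_< a) (+-identityʳ i) (above 0 z≤n)))

<rk⇒<part : ∀ p k → k < rk p → k < part p k
<rk⇒<part p = rkFrom-< 0 (parts p)

<part⇒<rk : ∀ p k → k < part p k → k < rk p
<part⇒<rk p k k<pk = rkFrom-> 0 (parts p) k (λ k′ k′≤k → <-≤-trans (s≤s k′≤k) (≤-trans k<pk (part-≤ p k′≤k)))

rk≤ℓ : ∀ p → rk p ≤ ℓ p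
rk≤ℓ p with rk p ≤? ℓ p
... | yes rk≤ℓ′ = rk≤ℓ′
... | no rk≰ℓ  = ⊥-elim (<-irrefl (sym (part-beyond p (ℓ p) ≤-refl))
                                  (≤-<-trans z≤n (<rk⇒<part p (ℓ p) (≰⇒> rk≰ℓ))))

<conjList⇒<nth : ∀ (l : List ℕ) → Descending l → ∀ k j → j < length (filter (k <?_) l) → k < nth l j
<conjList⇒<nth (a ∷ l) l↓ k j j<c with k <ᵇ a in k<ᵇa
<conjList⇒<nth (a ∷ l) l↓ k zero    j<c | true = <ᵇ⇒< k a (subst T (sym k<ᵇa) tt)
<conjList⇒<nth (a ∷ l) l↓ k (suc j) j<c | true = <conjList⇒<nth l (Linked-tail l↓) k j (≤-pred j<c)
... | false = ⊥-elim (subst T k<ᵇa (<⇒<ᵇ (<-≤-trans (<conjList⇒<nth l (Linked-tail l↓) k j j<c)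
                                                     (antitone⇒≤ (nth-antitone (a ∷ l) l↓) {0} {suc j} z≤n))))

<nth⇒<conjList : ∀ (l : List ℕ) → Descending l → ∀ k j → k < nth l j → j < length (filter (k <?_) l)
<nth⇒<conjList (a ∷ l) l↓ k j k<lj with k <ᵇ a in k<ᵇa
<nth⇒<conjList (a ∷ l) l↓ k zero    k<lj | true = z<s
<nth⇒<conjList (a ∷ l) l↓ k (suc j) k<lj | true = s≤s (<nth⇒<conjList l (Linked-tail l↓) k j k<lj)
... | false = ⊥-elim (subst T k<ᵇa (<⇒<ᵇ (<-≤-trans k<lj (antitone⇒≤ (nth-antitone (a ∷ l) l↓) {0} {j} z≤n))))

<conjPart⇒<part : ∀ p k j → j < conjPart p k → k < part p j
<conjPart⇒<part p = <conjList⇒<nth (parts p) (decr p)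

<part⇒<conjPart : ∀ p k j → k < part p j → j < conjPart p k
<part⇒<conjPart p = <nth⇒<conjList (parts p) (decr p)

conjPart≤ℓ : ∀ p k → conjPart p k ≤ ℓ p
conjPart≤ℓ p k = length-filter (k <?_) (parts p)

conjPart-antitone : ∀ p → Antitone (conjPart p)
conjPart-antitone p k = ≤-from-< (λ j j<c → <part⇒<conjPart p k j (<⇒≤ (<conjPart⇒<part p (suc k) j j<c)))
  where
  ≤-from-< : ∀ {a b} → (∀ j → j < a → j < b) → a ≤ b
  ≤-from-< {zero}  _   = z≤n
  ≤-from-< {suc a} a⊆b = a⊆b a ≤-refl

positivePrefix : (ℕ → ℕ) → ℕ → List ℕ
positivePrefix f zero = []
positivePrefix f (suc L) with f 0
... | zero  = []
... | suc x = suc x ∷ positivePrefix (λ i → f (suc i)) L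

positivePrefix-nth : ∀ {f} L → Antitone f → (∀ i → L ≤ i → f i ≡ 0) → ∀ i → nth (positivePrefix f L) i ≡ f i
positivePrefix-nth         zero    f↓ f≡0 i = sym (f≡0 i z≤n)
positivePrefix-nth {f = f} (suc L) f↓ f≡0 i with f 0 in f0≡
... | zero = sym (n≤0⇒n≡0 (subst (f i ≤_) f0≡ (antitone⇒≤ f↓ {0} {i} z≤n)))
positivePrefix-nth         (suc L) f↓ f≡0 zero    | suc x = sym f0≡
positivePrefix-nth         (suc L) f↓ f≡0 (suc i) | suc x =
  positivePrefix-nth L (λ i → f↓ (suc i)) (λ i L≤i → f≡0 (suc i) (s≤s L≤i)) i

positivePrefix-positive : ∀ f L → All (0 <_) (positivePrefix f L)
positivePrefix-positive f zero = []
positivePrefix-positive f (suc L) with f 0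
... | zero  = []
... | suc x = z<s ∷ positivePrefix-positive (λ i → f (suc i)) L

positivePrefix-head : ∀ f L v → f 0 ≤ v →
                      Connected (λ a b → b ≤ a) (Data.Maybe.just v) (Data.List.head (positivePrefix f L))
positivePrefix-head f zero v f0≤v = just-nothing
positivePrefix-head f (suc L) v f0≤v with f 0
... | zero  = just-nothing
... | suc x = just f0≤v

positivePrefix-descending : ∀ {f} L → Antitone f → Descending (positivePrefix f L)
positivePrefix-descending         zero    f↓ = []
positivePrefix-descending {f = f} (suc L) f↓ with f 0 in f0≡
... | zero  = []
... | suc x = positivePrefix-head (λ i → f (suc i)) L (suc x) (subst (f 1 ≤_) f0≡ (f↓ 0))
              ∷′ positivePrefix-descending L (λ i → f↓ (suc i))

fromAntitone : (f : ℕ → ℕ) → ℕ → Antitone f → Partition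
fromAntitone f L f↓ = mkPartition (positivePrefix f L) (positivePrefix-positive f L) (positivePrefix-descending L f↓)

part-fromAntitone : ∀ f L (f↓ : Antitone f) → (∀ i → L ≤ i → f i ≡ 0) → ∀ i → part (fromAntitone f L f↓) i ≡ f i
part-fromAntitone f L f↓ = positivePrefix-nth L f↓

-- Skew shapes

path-crossesRow : ∀ {la mu i j i′ j′} → SkewCell la mu i j → SkewPath la mu i j i′ j′ →
                  ∀ k → i ≤ k → k < i′ → ∃ λ col → SkewCell la mu k col × SkewCell la mu (suc k) col
path-crossesRow c here k i≤k k<i = ⊥-elim (<-irrefl refl (≤-<-trans i≤k k<i))
path-crossesRow {i = i} {j = j} c (step (down .i .j) c′ rest) k i≤k k<i′ with m≤n⇒m<n∨m≡n i≤k
... | inj₂ refl = j , c , c′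
... | inj₁ i<k  = path-crossesRow c′ rest k i<k k<i′
path-crossesRow c (step (up i j)    c′ rest) k i≤k k<i′ = path-crossesRow c′ rest k (≤-trans (n≤1+n i) i≤k) k<i′
path-crossesRow c (step (right i j) c′ rest) k i≤k k<i′ = path-crossesRow c′ rest k i≤k k<i′
path-crossesRow c (step (left i j)  c′ rest) k i≤k k<i′ = path-crossesRow c′ rest k i≤k k<i′

_++ₚ_ : ∀ {la mu i j i′ j′ i″ j″} → SkewPath la mu i j i′ j′ → SkewPath la mu i′ j′ i″ j″ →
        SkewPath la mu i j i″ j″
here         ++ₚ q = q
step a c rest ++ₚ q = step a c (rest ++ₚ q)

Adj-sym : ∀ {i j i′ j′} → Adj i j i′ j′ → Adj i′ j′ i j
Adj-sym (down i j)  = up i j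
Adj-sym (up i j)    = down i j
Adj-sym (right i j) = left i j
Adj-sym (left i j)  = right i j

reversePath : ∀ {la mu i j i′ j′} → SkewCell la mu i j → SkewPath la mu i j i′ j′ → SkewPath la mu i′ j′ i j
reversePath c here            = here
reversePath c (step a c′ rest) = reversePath c′ rest ++ₚ step (Adj-sym a) c here

-- The abacus

module Abacus (t n : ℕ) .{{_ : NonZero t}} (p : Partition) (ℓ≤m : ℓ p ≤ t * n) where

  m : ℕ
  m = t * n

  β : ℕ → ℕ
  β = betaEntry p m

  r : ℕ
  r = rk p

  α : ℕ → ℕ
  α = frobα p

  γ : ℕ → ℕ
  γ k = m ∸ suc (frobβ p k)

  r≤m : r ≤ m
  r≤m = ≤-trans (rk≤ℓ p) ℓ≤m

  β-strictlyAntitone : StrictlyAntitoneBelow m β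
  β-strictlyAntitone j 1+j<m = +-mono-≤-< (part-antitone p j) (∸-monoʳ-< (n<1+n (suc j)) 1+j<m)

  β-upper : ∀ j → j < r → β j ≡ m + α j
  β-upper j j<r = begin
    part p j + (m ∸ suc j)  ≡⟨ +-∸-assoc (part p j) (≤-trans j<r r≤m) ⟨
    part p j + m ∸ suc j    ≡⟨ cong (_∸ suc j) (+-comm (part p j) m) ⟩
    m + part p j ∸ suc j    ≡⟨ +-∸-assoc m (<rk⇒<part p j j<r) ⟩
    m + α j                 ∎
    where open ≡-Reasoning

  β-lower : ∀ j → r ≤ j → j < m → β j < m
  β-lower j r≤j j<m = begin-strict
    part p j + (m ∸ suc j)  <⟨ +-monoˡ-< (m ∸ suc j) (s≤s (≮⇒≥ (λ j<pj → <⇒≱ (<part⇒<rk p j j<pj) r≤j))) ⟩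
    suc j + (m ∸ suc j)     ≡⟨ m+[n∸m]≡n j<m ⟩
    m                       ∎
    where open ≤-Reasoning

  suc-frobβ≤conjPart : ∀ k → k < r → suc (frobβ p k) ≤ conjPart p k
  suc-frobβ≤conjPart k k<r = begin
    suc (conjPart p k ∸ suc k)  ≡⟨ ∸-suc (conjPart p k) k (<part⇒<conjPart p k k (<rk⇒<part p k k<r)) ⟨
    conjPart p k ∸ k            ≤⟨ m∸n≤m (conjPart p k) k ⟩
    conjPart p k                ∎
    where open ≤-Reasoning

  suc-frobβ≤m : ∀ k → k < r → suc (frobβ p k) ≤ m
  suc-frobβ≤m k k<r = ≤-trans (suc-frobβ≤conjPart k k<r) (≤-trans (conjPart≤ℓ p k) ℓ≤m)

  γ+suc-frobβ≡m : ∀ k → k < r → γ k + suc (frobβ p k) ≡ m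
  γ+suc-frobβ≡m k k<r = m∸n+n≡m (suc-frobβ≤m k k<r)

  γ<m : ∀ k → k < r → γ k < m
  γ<m k k<r = ∸-monoʳ-< {m} {suc (frobβ p k)} {0} z<s (suc-frobβ≤m k k<r)

  frobβ-strictlyAntitone : StrictlyAntitoneBelow r (frobβ p)
  frobβ-strictlyAntitone k 1+k<r =
    <-≤-trans (∸-monoʳ-< (n<1+n (suc k)) (<part⇒<conjPart p (suc k) (suc k) (<rk⇒<part p (suc k) 1+k<r)))
              (∸-monoˡ-≤ (suc k) (conjPart-antitone p k))

  γ-injective : InjectiveBelow r γ
  γ-injective k k′ k<r k′<r γk≡γk′ = strictlyAntitone⇒injective frobβ-strictlyAntitone k k′ k<r k′<r
    (suc-injective (∸-cancelˡ-≡ (suc-frobβ≤m k k<r) (suc-frobβ≤m k′ k′<r) γk≡γk′))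

  -- β j = γ k would force λ_{j+1} + λ′_{k+1} = j + k + 1, i.e. the cell (j , k)
  -- would lie neither inside nor outside the diagram.
  β≢γ : ∀ j k → j < m → k < r → β j ≢ γ k
  β≢γ j k j<m k<r βj≡γk = cell-nowhere (k <? part p j)
    where
    hook-length : part p j + conjPart p k ≡ suc (j + k)
    hook-length = +-cancelˡ-≡ m _ _ (begin
      m + (part p j + conjPart p k)
        ≡⟨ solve 3 (λ M P C → M :+ (P :+ C) := P :+ M :+ C) refl m (part p j) (conjPart p k) ⟩
      part p j + m + conjPart p k           ≡⟨ cong₂ _+_ βj+1+j (trans (sym (+-suc (frobβ p k) k)) k+1+fβ) ⟨
      β j + suc j + (suc (frobβ p k) + k)   ≡⟨ cong (λ x → x + suc j + (suc (frobβ p k) + k)) βj≡γk ⟩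
      γ k + suc j + (suc (frobβ p k) + k)
        ≡⟨ solve 4 (λ G J F K → G :+ J :+ (F :+ K) := G :+ F :+ (J :+ K)) refl (γ k) (suc j) (suc (frobβ p k)) k ⟩
      γ k + suc (frobβ p k) + (suc j + k)   ≡⟨ cong (_+ (suc j + k)) (γ+suc-frobβ≡m k k<r) ⟩
      m + suc (j + k)                       ∎)
      where
      open ≡-Reasoning
      βj+1+j : β j + suc j ≡ part p j + m
      βj+1+j = trans (+-assoc (part p j) _ _) (cong (part p j +_) (m∸n+n≡m j<m))
      k+1+fβ : frobβ p k + suc k ≡ conjPart p k
      k+1+fβ = m∸n+n≡m (<part⇒<conjPart p k k (<rk⇒<part p k k<r))
    cell-nowhere : Dec (k < part p j) → ⊥
    cell-nowhere (yes k<pj) = <-irrefl (sym hook-length) (begin-strict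
      suc (j + k)                 <⟨ s≤s (≤-reflexive (trans (cong suc (+-comm j k)) (sym (+-suc k j)))) ⟩
      suc k + suc j               ≤⟨ +-mono-≤ k<pj (<part⇒<conjPart p k j k<pj) ⟩
      part p j + conjPart p k     ∎)
      where open ≤-Reasoning
    cell-nowhere (no k≮pj) = <-irrefl hook-length (s≤s (begin
      part p j + conjPart p k     ≤⟨ +-mono-≤ (≮⇒≥ k≮pj) (≮⇒≥ (λ j<c → k≮pj (<conjPart⇒<part p k j j<c))) ⟩
      k + j                       ≡⟨ +-comm k j ⟩
      j + k                       ∎))
      where open ≤-Reasoning

  [m+x]%t≡x%t : ∀ x → (m + x) % t ≡ x % t
  [m+x]%t≡x%t x = trans (cong (_% t) (trans (+-comm m x) (cong (x +_) (*-comm t n)))) ([m+kn]%n≡m%n x n t)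

  lowβ : ℕ → ℕ
  lowβ k = β (r + k)

  r+k<m : ∀ k → k < m ∸ r → r + k < m
  r+k<m k k<m∸r = subst (r + k <_) (m+[n∸m]≡n r≤m) (+-monoʳ-< r k<m∸r)

  lowβ<m : ∀ k → k < m ∸ r → lowβ k < m
  lowβ<m k k<m∸r = β-lower (r + k) (m≤m+n r k) (r+k<m k k<m∸r)

  lowβ-injective : InjectiveBelow (m ∸ r) lowβ
  lowβ-injective = strictlyAntitone⇒injective λ k 1+k<m∸r →
    subst (λ i → β i < β (r + k)) (sym (+-suc r k))
          (β-strictlyAntitone (r + k) (subst (_< m) (+-suc r k) (r+k<m (suc k) 1+k<m∸r)))

  lowBeadAt gapAt : ℕ → ℕ
  lowBeadAt x = sumTo (m ∸ r) (λ k → δ (lowβ k) x)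
  gapAt x     = sumTo r (λ k → δ (γ k) x)

  lowBeadAt+gapAt≤1 : ∀ x → lowBeadAt x + gapAt x ≤ 1
  lowBeadAt+gapAt≤1 x with 0 <? lowBeadAt x
  ... | no none = subst (λ b → b + gapAt x ≤ 1) (sym (n≤0⇒n≡0 (≮⇒≥ none))) (multiplicity≤1 r γ x γ-injective)
  ... | yes some with sumRange-positive 0 (m ∸ r) _ some
  ...   | k , _ , k<m∸r , hit = subst (_≤ 1) (sym (trans (cong (lowBeadAt x +_) noGap) (+-identityʳ _)))
                                      (multiplicity≤1 (m ∸ r) lowβ x lowβ-injective)
    where
    noGap : gapAt x ≡ 0
    noGap = sumRange-zeros 0 r (λ k′ _ k′<r → δ-no (λ γk′≡x →
              β≢γ (r + k) k′ (r+k<m k k<m∸r) k′<r (trans (χ-pos (lowβ k ≟ x) hit) (sym γk′≡x))))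

  Σ-lowBeadAt : sumTo m lowBeadAt ≡ m ∸ r
  Σ-lowBeadAt = trans (sumRange-cong 0 m (λ x _ _ → sym (*-identityʳ (lowBeadAt x))))
                      (trans (sym (sumTo-reindex (m ∸ r) m lowβ (λ _ → 1) lowβ<m)) (sumTo-ones (m ∸ r)))

  Σ-gapAt : sumTo m gapAt ≡ r
  Σ-gapAt = trans (sumRange-cong 0 m (λ x _ _ → sym (*-identityʳ (gapAt x))))
                  (trans (sym (sumTo-reindex r m γ (λ _ → 1) γ<m)) (sumTo-ones r))

  lowBeadAt+gapAt≡1 : ∀ x → x < m → lowBeadAt x + gapAt x ≡ 1
  lowBeadAt+gapAt≡1 = sumTo-forces-ones m (λ x → lowBeadAt x + gapAt x) (λ x _ → lowBeadAt+gapAt≤1 x)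
    (≤-reflexive (sym (begin
      sumTo m (λ x → lowBeadAt x + gapAt x)   ≡⟨ sumRange-+ 0 m lowBeadAt gapAt ⟩
      sumTo m lowBeadAt + sumTo m gapAt       ≡⟨ cong₂ _+_ Σ-lowBeadAt Σ-gapAt ⟩
      m ∸ r + r                               ≡⟨ m∸n+n≡m r≤m ⟩
      m                                       ∎)))
    where open ≡-Reasoning

  lowBeads-and-gaps-tile : ∀ g → sumTo (m ∸ r) (λ k → g (lowβ k)) + sumTo r (λ k → g (γ k)) ≡ sumTo m g
  lowBeads-and-gaps-tile g = begin
    sumTo (m ∸ r) (λ k → g (lowβ k)) + sumTo r (λ k → g (γ k))
      ≡⟨ cong₂ _+_ (sumTo-reindex (m ∸ r) m lowβ g lowβ<m) (sumTo-reindex r m γ g γ<m) ⟩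
    sumTo m (λ x → lowBeadAt x * g x) + sumTo m (λ x → gapAt x * g x)
      ≡⟨ sumRange-+ 0 m _ _ ⟨
    sumTo m (λ x → lowBeadAt x * g x + gapAt x * g x)
      ≡⟨ sumRange-cong 0 m (λ x _ x<m → trans (sym (*-distribʳ-+ (g x) (lowBeadAt x) (gapAt x)))
                                             (trans (cong (_* g x) (lowBeadAt+gapAt≡1 x x<m)) (*-identityˡ (g x)))) ⟩
    sumTo m g ∎
    where open ≡-Reasoning

  -- The indicator inside nCount is local to its definition, so it is reached through the unfolding.
  nCount-as-sum : ∀ i → nCount t p m i ≡ sumTo m (λ j → δ (β j % t) i)
  nCount-as-sum i = trans (proj₂ (unfold i)) (sumRange-cong 0 m (λ j _ _ → pointwise i j))
    where
    unfold : ∀ i → Σ (ℕ → ℕ) (λ f → nCount t p m i ≡ sumTo m f)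
    unfold i = _ , refl
    pointwise : ∀ i j → proj₁ (unfold i) j ≡ δ (β j % t) i
    pointwise i j with β j % t ≟ i
    ... | yes _ = refl
    ... | no _  = refl

  countα countγ : ℕ → ℕ
  countα i = sumTo r (λ k → δ (α k % t) i)
  countγ i = sumTo r (λ k → δ (γ k % t) i)

  nCount-split : ∀ i → nCount t p m i ≡ countα i + sumTo (m ∸ r) (λ k → δ (lowβ k % t) i)
  nCount-split i = begin
    nCount t p m i                                    ≡⟨ nCount-as-sum i ⟩
    sumTo m (λ j → δ (β j % t) i)                     ≡⟨ cong (λ N → sumTo N (λ j → δ (β j % t) i)) (m+[n∸m]≡n r≤m) ⟨
    sumTo (r + (m ∸ r)) (λ j → δ (β j % t) i)         ≡⟨ sumTo-split r (m ∸ r) _ ⟩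
    sumTo r (λ j → δ (β j % t) i) + sumTo (m ∸ r) (λ k → δ (lowβ k % t) i)
      ≡⟨ cong (_+ sumTo (m ∸ r) (λ k → δ (lowβ k % t) i))
              (sumRange-cong 0 r (λ j _ j<r → cong (λ y → δ y i) (upper-residue j j<r))) ⟩
    countα i + sumTo (m ∸ r) (λ k → δ (lowβ k % t) i) ∎
    where
    open ≡-Reasoning
    upper-residue : ∀ j → j < r → β j % t ≡ α j % t
    upper-residue j j<r = trans (cong (_% t) (β-upper j j<r)) ([m+x]%t≡x%t (α j))

  nCount+countγ≡n+countα : ∀ i → i < t → nCount t p m i + countγ i ≡ n + countα i
  nCount+countγ≡n+countα i i<t = begin
    nCount t p m i + countγ i                                   ≡⟨ cong (_+ countγ i) (nCount-split i) ⟩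
    countα i + sumTo (m ∸ r) (λ k → δ (lowβ k % t) i) + countγ i ≡⟨ +-assoc (countα i) _ _ ⟩
    countα i + (sumTo (m ∸ r) (λ k → δ (lowβ k % t) i) + countγ i)
      ≡⟨ cong (countα i +_) (lowBeads-and-gaps-tile (λ x → δ (x % t) i)) ⟩
    countα i + sumTo m (λ x → δ (x % t) i)                      ≡⟨ cong (countα i +_) (residue-count t n i i<t) ⟩
    countα i + n                                                ≡⟨ +-comm (countα i) n ⟩
    n + countα i                                                ∎
    where open ≡-Reasoning

  IsBead : ℕ → Set
  IsBead y = ∃ λ j → j < m × β j ≡ y

  Flush : Set
  Flush = ∀ y → IsBead y → t ≤ y → IsBead (y ∸ t)

  flush-iterate : Flush → ∀ x q → IsBead (x + q * t) → IsBead x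
  flush-iterate flush x zero    bead = subst IsBead (+-identityʳ x) bead
  flush-iterate flush x (suc q) bead = flush-iterate flush x q (subst IsBead x+qt (flush _ bead t≤))
    where
    x+qt : x + suc q * t ∸ t ≡ x + q * t
    x+qt = trans (cong (_∸ t) (solve 3 (λ X Q T → X :+ (T :+ Q :* T) := X :+ Q :* T :+ T) refl x q t))
                 (m+n∸n≡m (x + q * t) t)
    t≤ : t ≤ x + suc q * t
    t≤ = ≤-trans (m≤m+n t (q * t)) (m≤n+m (suc q * t) x)

  -- m + α k is a bead and γ k′ is a gap below it on the same runner.
  flush⇒α≢γ : Flush → ∀ k k′ → k < r → k′ < r → α k % t ≢ γ k′ % t
  flush⇒α≢γ flush k k′ k<r k′<r α≡γ
    with ≡-mod⇒+multiple t (γ k′) (m + α k) (trans (sym α≡γ) (sym ([m+x]%t≡x%t (α k))))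
                           (≤-trans (<⇒≤ (γ<m k′ k′<r)) (m≤m+n m (α k)))
  ... | q , m+α≡ with flush-iterate flush (γ k′) q (k , ≤-trans k<r r≤m , trans (β-upper k k<r) m+α≡)
  ...   | j , j<m , βj≡γk′ = β≢γ j k′ j<m k′<r βj≡γk′


  flush⇒countα≡0⊎countγ≡0 : Flush → ∀ i → countα i ≡ 0 ⊎ countγ i ≡ 0
  flush⇒countα≡0⊎countγ≡0 flush i with 0 <? countα i | 0 <? countγ i
  ... | no noα  | _       = inj₁ (n≤0⇒n≡0 (≮⇒≥ noα))
  ... | yes _   | no noγ  = inj₂ (n≤0⇒n≡0 (≮⇒≥ noγ))
  ... | yes someα | yes someγ with sumRange-positive 0 r _ someα | sumRange-positive 0 r _ someγ
  ...   | k , _ , k<r , hitα | k′ , _ , k′<r , hitγ =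
    ⊥-elim (flush⇒α≢γ flush k k′ k<r k′<r (trans (χ-pos (α k % t ≟ i) hitα) (sym (χ-pos (γ k′ % t ≟ i) hitγ))))

  flush⇒∣nCount-n∣ : Flush → ∀ i → i < t → ∣ nCount t p m i - n ∣ ≡ countα i + countγ i
  flush⇒∣nCount-n∣ flush i i<t with flush⇒countα≡0⊎countγ≡0 flush i
  ... | inj₁ α≡0 = begin
    ∣ nCount t p m i - n ∣                       ≡⟨ cong (λ y → ∣ nCount t p m i - y ∣) balance ⟨
    ∣ nCount t p m i - (nCount t p m i + countγ i) ∣ ≡⟨ m≤n⇒∣m-n∣≡n∸m (m≤m+n (nCount t p m i) (countγ i)) ⟩
    nCount t p m i + countγ i ∸ nCount t p m i   ≡⟨ m+n∸m≡n (nCount t p m i) (countγ i) ⟩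
    countγ i                                     ≡⟨ cong (_+ countγ i) α≡0 ⟨
    countα i + countγ i                          ∎
    where
    open ≡-Reasoning
    balance : nCount t p m i + countγ i ≡ n
    balance = trans (nCount+countγ≡n+countα i i<t) (trans (cong (n +_) α≡0) (+-identityʳ n))
  ... | inj₂ γ≡0 = begin
    ∣ nCount t p m i - n ∣                       ≡⟨ cong (λ y → ∣ y - n ∣) balance ⟩
    ∣ n + countα i - n ∣                         ≡⟨ m≤n⇒∣n-m∣≡n∸m (m≤m+n n (countα i)) ⟩
    n + countα i ∸ n                             ≡⟨ m+n∸m≡n n (countα i) ⟩
    countα i                                     ≡⟨ +-identityʳ _ ⟨
    countα i + 0                                 ≡⟨ cong (countα i +_) γ≡0 ⟨
    countα i + countγ i                          ∎
    where
    open ≡-Reasoning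
    balance : nCount t p m i ≡ n + countα i
    balance = trans (sym (+-identityʳ _)) (trans (cong (nCount t p m i +_) (sym γ≡0)) (nCount+countγ≡n+countα i i<t))

  sumRange-countα+countγ : ∀ lo hi → sumRange lo hi (λ i → countα i + countγ i) ≡
                           sumTo r (λ k → sumRange lo hi (δ (α k % t)) + sumRange lo hi (δ (γ k % t)))
  sumRange-countα+countγ lo hi = begin
    sumRange lo hi (λ i → countα i + countγ i)
      ≡⟨ sumRange-+ lo hi countα countγ ⟩
    sumRange lo hi countα + sumRange lo hi countγ
      ≡⟨ cong₂ _+_ (sumRange-swap lo hi 0 r (λ i k → δ (α k % t) i)) (sumRange-swap lo hi 0 r (λ i k → δ (γ k % t) i)) ⟩
    sumTo r (λ k → sumRange lo hi (δ (α k % t))) + sumTo r (λ k → sumRange lo hi (δ (γ k % t)))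
      ≡⟨ sumRange-+ 0 r _ _ ⟨
    sumTo r (λ k → sumRange lo hi (δ (α k % t)) + sumRange lo hi (δ (γ k % t))) ∎
    where open ≡-Reasoning

-- Rim hooks

module StripRemoval (t n : ℕ) .{{_ : NonZero t}} (la mu : Partition) (ℓ≤m : ℓ la ≤ t * n)
                    (strip : RemovesStrip t la mu) where

  m : ℕ
  m = t * n

  L U : ℕ → ℕ
  L = part la
  U = part mu

  U≤L : ∀ i → U i ≤ L i
  U≤L = proj₁ strip

  size : sumTo (ℓ la) (λ i → L i ∸ U i) ≡ t
  size = proj₁ (proj₂ strip)

  Changed : ℕ → Set
  Changed i = U i < L i

  unchanged : ∀ i → ¬ Changed i → U i ≡ L i
  unchanged i ¬changed = ≤-antisym (U≤L i) (≮⇒≥ ¬changed)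

  changed⇒<ℓ : ∀ i → Changed i → i < ℓ la
  changed⇒<ℓ i Ui<Li = part-positive⇒<ℓ la i (≤-<-trans z≤n Ui<Li)

  ℓmu≤m : ℓ mu ≤ m
  ℓmu≤m = ≤-trans (ℓ-mono mu la U≤L) ℓ≤m

  some-changed : ∃ Changed
  some-changed with sumRange-positive 0 (ℓ la) _ (subst (0 <_) (sym size) (>-nonZero⁻¹ t))
  ... | i , _ , _ , Li∸Ui>0 = i , ≰⇒> (λ Li≤Ui → <-irrefl (sym (m≤n⇒m∸n≡0 Li≤Ui)) Li∸Ui>0)

  first : ∃ λ a → Changed a × a ≤ proj₁ some-changed × (∀ j → j < a → ¬ Changed j)
  first = least-witness Changed (λ i → U i <? L i) (proj₁ some-changed) (proj₂ some-changed)
  a : ℕ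
  a = proj₁ first

  last : ∃ λ b → Changed b × a ≤ b × (∀ j → b < j → ¬ Changed j)
  last = greatest-witness Changed (λ i → U i <? L i) (ℓ la) (λ i ℓ≤i c → <⇒≱ (changed⇒<ℓ i c) ℓ≤i)
                          a (proj₁ (proj₂ first))
  b : ℕ
  b = proj₁ last

  changed-a : Changed a
  changed-a = proj₁ (proj₂ first)
  changed-b : Changed b
  changed-b = proj₁ (proj₂ last)
  a≤b : a ≤ b
  a≤b = proj₁ (proj₂ (proj₂ last))

  outside⇒unchanged : ∀ i → i < a ⊎ b < i → U i ≡ L i
  outside⇒unchanged i (inj₁ i<a) = unchanged i (proj₂ (proj₂ (proj₂ first)) i i<a)
  outside⇒unchanged i (inj₂ b<i) = unchanged i (proj₂ (proj₂ (proj₂ last)) i b<i)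

  b<m : b < m
  b<m = ≤-trans (changed⇒<ℓ b changed-b) ℓ≤m

  first-cell : SkewCell la mu a (U a)
  first-cell = ≤-refl , changed-a

  last-cell : SkewCell la mu b (U b)
  last-cell = ≤-refl , changed-b

  connected : ∀ i j i′ j′ → SkewCell la mu i j → SkewCell la mu i′ j′ → SkewPath la mu i j i′ j′
  connected = proj₂ (proj₂ (proj₂ strip))

  -- A path from row a to row b inside the strip crosses each row boundary k, so rows k and k+1
  -- share a column; without a 2 × 2 square they share exactly one, which forces L (k+1) = U k + 1.
  rim-step : ∀ k → a ≤ k → k < b → L (suc k) ≡ U k + 1
  rim-step k a≤k k<b with path-crossesRow first-cell (connected a (U a) b (U b) first-cell last-cell) k a≤k k<b
  ... | col , (Uk≤col , _) , (_ , col<Lk+1) =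
    ≤-antisym (≮⇒≥ overlap>1) (subst (_≤ L (suc k)) (+-comm 1 (U k)) (≤-<-trans Uk≤col col<Lk+1))
    where
    no-square : ∀ i j → ¬ (SkewCell la mu i j × SkewCell la mu (suc i) j ×
                           SkewCell la mu i (suc j) × SkewCell la mu (suc i) (suc j))
    no-square = proj₁ (proj₂ (proj₂ strip))
    overlap>1 : U k + 1 < L (suc k) → ⊥
    overlap>1 Uk+2≤ = no-square k (U k)
      ( (≤-refl , ≤-trans (≤-trans (n≤1+n _) Uk+2≤′) (part-antitone la k))
      , (part-antitone mu k , ≤-trans (n≤1+n _) Uk+2≤′)
      , (n≤1+n (U k) , ≤-trans Uk+2≤′ (part-antitone la k))
      , (≤-trans (part-antitone mu k) (n≤1+n (U k)) , Uk+2≤′))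
      where
      Uk+2≤′ : suc (suc (U k)) ≤ L (suc k)
      Uk+2≤′ = subst (_≤ L (suc k)) (cong suc (+-comm (U k) 1)) Uk+2≤

  d : ℕ
  d = b ∸ a

  a+d≡b : a + d ≡ b
  a+d≡b = m+[n∸m]≡n a≤b

  a+1+d≡1+b : a + suc d ≡ suc b
  a+1+d≡1+b = trans (+-suc a d) (cong suc a+d≡b)

  a+k<b : ∀ k → k < d → a + k < b
  a+k<b k k<d = subst (a + k <_) a+d≡b (+-monoʳ-< a k<d)

  outside-window : ∀ i → i < a ⊎ a + suc d ≤ i → U i ≡ L i
  outside-window i (inj₁ i<a)  = outside⇒unchanged i (inj₁ i<a)
  outside-window i (inj₂ past) = outside⇒unchanged i (inj₂ (subst (_≤ i) a+1+d≡1+b past))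

  strip-size : t + U b ≡ L a + d
  strip-size = begin
    t + U b               ≡⟨ cong (_+ U b) window-size ⟨
    Σwindow + U b         ≡⟨ cong (λ i → Σwindow + U i) a+d≡b ⟨
    Σwindow + U (a + d)   ≡⟨ sumTo-telescope L U a d U≤L (λ k k<d → rim-step (a + k) (m≤m+n a k) (a+k<b k k<d)) ⟩
    L a + d               ∎
    where
    open ≡-Reasoning
    Σwindow : ℕ
    Σwindow = sumTo (suc d) (λ k → L (a + k) ∸ U (a + k))
    window-size : Σwindow ≡ t
    window-size = trans (sym (sumTo-window (ℓ la) a (suc d) _ (subst (_≤ ℓ la) (sym a+1+d≡1+b) (changed⇒<ℓ b changed-b))
                                            (λ i out → trans (cong (L i ∸_) (outside-window i out)) (n∸n≡0 (L i)))))
                        size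

  βL βU : ℕ → ℕ
  βL = betaEntry la m
  βU = betaEntry mu m

  β-shifted : ∀ k → k < d → βU (a + k) ≡ βL (a + suc k)
  β-shifted k k<d = begin
    U (a + k) + (m ∸ suc (a + k))
      ≡⟨ cong (U (a + k) +_) (∸-suc m (suc (a + k)) (≤-trans (s≤s (a+k<b k k<d)) b<m)) ⟩
    U (a + k) + suc (m ∸ suc (suc (a + k)))       ≡⟨ +-suc (U (a + k)) _ ⟩
    suc (U (a + k)) + (m ∸ suc (suc (a + k)))
      ≡⟨ cong (_+ (m ∸ suc (suc (a + k))))
              (trans (+-comm 1 (U (a + k))) (sym (rim-step (a + k) (m≤m+n a k) (a+k<b k k<d)))) ⟩
    L (suc (a + k)) + (m ∸ suc (suc (a + k)))     ≡⟨ cong (λ i → L i + (m ∸ suc i)) (+-suc a k) ⟨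
    L (a + suc k) + (m ∸ suc (a + suc k))         ∎
    where open ≡-Reasoning

  β-moved : βL a ≡ βU b + t
  β-moved = begin
    L a + (m ∸ suc a)          ≡⟨ cong (L a +_) m∸1+a ⟩
    L a + (X + d)              ≡⟨ solve 3 (λ A X D → A :+ (X :+ D) := A :+ D :+ X) refl (L a) X d ⟩
    L a + d + X                ≡⟨ cong (_+ X) strip-size ⟨
    t + U b + X                ≡⟨ solve 3 (λ T B X → T :+ B :+ X := B :+ X :+ T) refl t (U b) X ⟩
    U b + X + t                ∎
    where
    open ≡-Reasoning
    X : ℕ
    X = m ∸ suc b
    m∸1+a : m ∸ suc a ≡ X + d
    m∸1+a = trans (∸-suc-shift m a d (subst (_≤ m) (cong suc (sym a+d≡b)) b<m))
                  (cong (λ i → m ∸ suc i + d) a+d≡b)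

  -- Rows a … b of the β-sequence are rotated and the moved entry drops by t, so residues are preserved.
  nCount-preserved : ∀ i → nCount t la m i ≡ nCount t mu m i
  nCount-preserved i = begin
    nCount t la m i         ≡⟨ Abacus.nCount-as-sum t n la ℓ≤m i ⟩
    sumTo m resL            ≡⟨ sumTo-around m a (suc d) resL window≤m ⟩
    sumTo a resL + (sumTo (suc d) (λ k → resL (a + k)) + sumRange (a + suc d) m resL)
                            ≡⟨ cong₂ _+_ (sumRange-cong 0 a (λ i _ i<a → same i (inj₁ i<a)))
                                         (cong₂ _+_ window
                                                    (sumRange-cong (a + suc d) m (λ i past _ → same i (inj₂ past)))) ⟩
    sumTo a resU + (sumTo (suc d) (λ k → resU (a + k)) + sumRange (a + suc d) m resU)
                            ≡⟨ sumTo-around m a (suc d) resU window≤m ⟨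
    sumTo m resU            ≡⟨ Abacus.nCount-as-sum t n mu ℓmu≤m i ⟨
    nCount t mu m i         ∎
    where
    open ≡-Reasoning
    resL resU : ℕ → ℕ
    resL j = δ (βL j % t) i
    resU j = δ (βU j % t) i
    window≤m : a + suc d ≤ m
    window≤m = subst (_≤ m) (sym a+1+d≡1+b) b<m
    same : ∀ j → j < a ⊎ a + suc d ≤ j → resL j ≡ resU j
    same j out = cong (λ x → δ ((x + (m ∸ suc j)) % t) i) (sym (outside-window j out))
    window : sumTo (suc d) (λ k → resL (a + k)) ≡ sumTo (suc d) (λ k → resU (a + k))
    window = begin
      sumTo (suc d) (λ k → resL (a + k))             ≡⟨ sumTo-cons d _ ⟩
      resL (a + 0) + sumTo d (λ k → resL (a + suc k))
        ≡⟨ cong₂ _+_ (cong (λ x → δ (x % t) i) (trans (cong βL (+-identityʳ a)) β-moved))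
                     (sumRange-cong 0 d (λ k _ k<d → cong (λ x → δ (x % t) i) (sym (β-shifted k k<d)))) ⟩
      δ ((βU b + t) % t) i + sumTo d (λ k → resU (a + k))
        ≡⟨ cong (λ x → δ x i + sumTo d (λ k → resU (a + k))) ([m+n]%n≡m%n (βU b) t) ⟩
      resU b + sumTo d (λ k → resU (a + k))          ≡⟨ cong (λ j → resU j + sumTo d (λ k → resU (a + k))) a+d≡b ⟨
      resU (a + d) + sumTo d (λ k → resU (a + k))    ≡⟨ +-comm (resU (a + d)) _ ⟩
      sumTo d (λ k → resU (a + k)) + resU (a + d)    ≡⟨ sumRange-suc (λ k → resU (a + k)) z≤n ⟨
      sumTo (suc d) (λ k → resU (a + k))             ∎

-- Sliding the bead β a down to the empty position β a ∸ t removes a rim hook of size t, occupying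
-- rows a … b where b is the last row whose bead lies above the target.
module StripAtBead (t n : ℕ) .{{_ : NonZero t}} (ka : Partition) (ℓ≤m : ℓ ka ≤ t * n)
                   (a : ℕ) (a<m : a < t * n) (t≤βa : t ≤ betaEntry ka (t * n) a)
                   (empty : ¬ (∃ λ j → j < t * n × betaEntry ka (t * n) j ≡ betaEntry ka (t * n) a ∸ t)) where

  open Abacus t n ka ℓ≤m using (m; β)

  L : ℕ → ℕ
  L = part ka

  target : ℕ
  target = β a ∸ t

  target<βa : target < β a
  target<βa = ∸-monoʳ-< {β a} {t} {0} (>-nonZero⁻¹ t) t≤βa

  Above : ℕ → Set
  Above j = j < m × target < β j

  lastAbove : ∃ λ b → Above b × a ≤ b × (∀ j → b < j → ¬ Above j)
  lastAbove = greatest-witness Above (λ j → (j <? m) ×-dec (target <? β j)) m (λ j m≤j above → <⇒≱ (proj₁ above) m≤j)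
                               a (a<m , target<βa)

  b : ℕ
  b = proj₁ lastAbove

  b<m : b < m
  b<m = proj₁ (proj₁ (proj₂ lastAbove))
  target<βb : target < β b
  target<βb = proj₂ (proj₁ (proj₂ lastAbove))
  a≤b : a ≤ b
  a≤b = proj₁ (proj₂ (proj₂ lastAbove))

  below-target : ∀ j → b < j → j < m → β j < target
  below-target j b<j j<m = ≤∧≢⇒< (≮⇒≥ (λ above → proj₂ (proj₂ (proj₂ lastAbove)) j b<j (j<m , above)))
                                (λ βj≡ → empty (j , j<m , βj≡))

  X : ℕ
  X = m ∸ suc b

  X≤target : X ≤ target
  X≤target with suc b <? m
  ... | yes 1+b<m = subst (_≤ target) (sym (∸-suc m (suc b) 1+b<m))
                          (≤-<-trans (m≤n+m _ (L (suc b))) (below-target (suc b) ≤-refl 1+b<m))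
  ... | no 1+b≮m  = subst (_≤ target) (sym (m≤n⇒m∸n≡0 (≮⇒≥ 1+b≮m))) z≤n

  newLast : ℕ
  newLast = target ∸ X

  newLast+X : newLast + X ≡ target
  newLast+X = m∸n+n≡m X≤target

  newLast<Lb : newLast < L b
  newLast<Lb = +-cancelʳ-< X newLast (L b) (subst (_< L b + X) (sym newLast+X) target<βb)

  L[1+b]≤newLast : L (suc b) ≤ newLast
  L[1+b]≤newLast with suc b <? m
  ... | no 1+b≮m  = subst (_≤ newLast) (sym (part-beyond ka (suc b) (≤-trans ℓ≤m (≮⇒≥ 1+b≮m)))) z≤n
  ... | yes 1+b<m = ≤-pred (+-cancelʳ-≤ Y (suc (L (suc b))) (suc newLast)
                                       (subst (suc (L (suc b) + Y) ≤_) target≡ (below-target (suc b) ≤-refl 1+b<m)))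
    where
    Y : ℕ
    Y = m ∸ suc (suc b)
    target≡ : target ≡ suc newLast + Y
    target≡ = trans (sym newLast+X) (trans (cong (newLast +_) (∸-suc m (suc b) 1+b<m)) (+-suc newLast Y))

  b<ℓ : b < ℓ ka
  b<ℓ = part-positive⇒<ℓ ka b (≤-<-trans z≤n newLast<Lb)

  U : ℕ → ℕ
  U i with i <? a
  ... | yes _ = L i
  ... | no _ with i <? b
  ...   | yes _ = L (suc i) ∸ 1
  ...   | no _ with i ≟ b
  ...     | yes _ = newLast
  ...     | no _  = L i

  U-before : ∀ i → i < a → U i ≡ L i
  U-before i i<a with i <? a
  ... | yes _  = refl
  ... | no i≮a = ⊥-elim (i≮a i<a)

  U-inside : ∀ i → a ≤ i → i < b → U i ≡ L (suc i) ∸ 1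
  U-inside i a≤i i<b with i <? a
  ... | yes i<a = ⊥-elim (<⇒≱ i<a a≤i)
  ... | no _ with i <? b
  ...   | yes _  = refl
  ...   | no i≮b = ⊥-elim (i≮b i<b)

  U-last : U b ≡ newLast
  U-last with b <? a
  ... | yes b<a = ⊥-elim (<⇒≱ b<a a≤b)
  ... | no _ with b <? b
  ...   | yes b<b = ⊥-elim (<-irrefl refl b<b)
  ...   | no _ with b ≟ b
  ...     | yes _  = refl
  ...     | no b≢b = ⊥-elim (b≢b refl)

  U-after : ∀ i → b < i → U i ≡ L i
  U-after i b<i with i <? a
  ... | yes i<a = ⊥-elim (<⇒≱ (≤-trans i<a a≤b) (<⇒≤ b<i))
  ... | no _ with i <? b
  ...   | yes i<b = ⊥-elim (<-asym i<b b<i)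
  ...   | no _ with i ≟ b
  ...     | yes i≡b = ⊥-elim (<-irrefl (sym i≡b) b<i)
  ...     | no _    = refl

  data Region (i : ℕ) : Set where
    before : i < a → Region i
    inside : a ≤ i → i < b → Region i
    last   : i ≡ b → Region i
    after  : b < i → Region i

  region : ∀ i → Region i
  region i with i <? a
  ... | yes i<a = before i<a
  ... | no i≮a with <-cmp i b
  ...   | tri< i<b _ _ = inside (≮⇒≥ i≮a) i<b
  ...   | tri≈ _ i≡b _ = last i≡b
  ...   | tri> _ _ b<i = after b<i

  U≤L : ∀ i → U i ≤ L i
  U≤L i with region i
  ... | before i<a     = ≤-reflexive (U-before i i<a)
  ... | inside a≤i i<b = subst (_≤ L i) (sym (U-inside i a≤i i<b)) (≤-trans (m∸n≤m _ 1) (part-antitone ka i))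
  ... | last refl      = subst (_≤ L b) (sym U-last) (<⇒≤ newLast<Lb)
  ... | after b<i      = ≤-reflexive (U-after i b<i)

  U-antitone : Antitone U
  U-antitone i with region i
  ... | before i<a = subst (U (suc i) ≤_) (sym (U-before i i<a)) (≤-trans (U≤L (suc i)) (part-antitone ka i))
  ... | last refl  = subst₂ _≤_ (sym (U-after (suc b) ≤-refl)) (sym U-last) L[1+b]≤newLast
  ... | after b<i  = subst₂ _≤_ (sym (U-after (suc i) (m<n⇒m<1+n b<i))) (sym (U-after i b<i)) (part-antitone ka i)
  ... | inside a≤i i<b with m≤n⇒m<n∨m≡n i<b
  ...   | inj₁ 1+i<b = subst₂ _≤_ (sym (U-inside (suc i) (≤-trans a≤i (n≤1+n i)) 1+i<b)) (sym (U-inside i a≤i i<b))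
                                  (∸-monoˡ-≤ 1 (part-antitone ka (suc i)))
  ...   | inj₂ 1+i≡b = subst (λ w → U w ≤ U i) (sym 1+i≡b)
                         (subst₂ _≤_ (sym U-last) (sym (U-inside i a≤i i<b))
                                 (subst (λ w → newLast ≤ L w ∸ 1) (sym 1+i≡b) (∸-monoˡ-≤ 1 newLast<Lb)))

  mu : Partition
  mu = fromAntitone U (ℓ ka) U-antitone

  part-mu : ∀ i → part mu i ≡ U i
  part-mu = part-fromAntitone U (ℓ ka) U-antitone
                              (λ i ℓ≤i → trans (U-after i (<-≤-trans b<ℓ ℓ≤i)) (part-beyond ka i ℓ≤i))

  changed⇒inWindow : ∀ i → part mu i < L i → a ≤ i × i ≤ b
  changed⇒inWindow i changed with region i
  ... | before i<a     = ⊥-elim (<-irrefl (trans (part-mu i) (U-before i i<a)) changed)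
  ... | inside a≤i i<b = a≤i , <⇒≤ i<b
  ... | last i≡b       = subst (a ≤_) (sym i≡b) a≤b , ≤-reflexive i≡b
  ... | after b<i      = ⊥-elim (<-irrefl (trans (part-mu i) (U-after i b<i)) changed)

  cell⇒inWindow : ∀ {i c} → SkewCell ka mu i c → a ≤ i × i ≤ b
  cell⇒inWindow {i} (mu≤c , c<L) = changed⇒inWindow i (≤-<-trans mu≤c c<L)

  rim-step : ∀ k → a ≤ k → k < b → L (suc k) ≡ part mu k + 1
  rim-step k a≤k k<b = sym (trans (cong (_+ 1) (trans (part-mu k) (U-inside k a≤k k<b)))
                                  (m∸n+n≡m (<-≤-trans (≤-<-trans z≤n newLast<Lb) (part-≤ ka k<b))))

  no-square : ∀ i j → ¬ (SkewCell ka mu i j × SkewCell ka mu (suc i) j ×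
                         SkewCell ka mu i (suc j) × SkewCell ka mu (suc i) (suc j))
  no-square i j ((mu≤j , _) , _ , (_ , 1+j<L) , (mu′≤1+j , 1+j<L′))
    with changed⇒inWindow i (≤-<-trans mu≤j (≤-trans (n≤1+n _) 1+j<L))
       | changed⇒inWindow (suc i) (≤-<-trans mu′≤1+j 1+j<L′)
  ... | a≤i , _ | _ , 1+i≤b = <-irrefl refl (≤-<-trans mu≤j
          (+-cancelʳ-≤ 1 (suc j) (part mu i) (subst₂ _≤_ (+-comm 1 (suc j)) (rim-step i a≤i 1+i≤b) 1+j<L′)))

  walkLeft : ∀ i c → part mu i ≤ c → c < L i → SkewPath ka mu i c i (part mu i)
  walkLeft i c mu≤c c<L with m≤n⇒m<n∨m≡n mu≤c
  ... | inj₂ mu≡c = subst (SkewPath ka mu i c i) (sym mu≡c) here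
  walkLeft i (suc c) mu≤c c<L | inj₁ mu<1+c =
    step (left i c) (≤-pred mu<1+c , <-trans (n<1+n c) c<L) (walkLeft i c (≤-pred mu<1+c) (<-trans (n<1+n c) c<L))

  pathToLast : ∀ g i c → g + i ≡ b → SkewCell ka mu i c → SkewPath ka mu i c b (part mu b)
  pathToLast zero    i c i≡b cell =
    subst (λ w → SkewPath ka mu i c w (part mu w)) i≡b (walkLeft i c (proj₁ cell) (proj₂ cell))
  pathToLast (suc g) i c g+i≡b cell =
    walkLeft i c (proj₁ cell) (proj₂ cell) ++ₚ
    step (down i (part mu i)) cell-below (pathToLast g (suc i) (part mu i) (trans (+-suc g i) g+i≡b) cell-below)
    where
    i<b : i < b
    i<b = subst (i <_) g+i≡b (s≤s (m≤n+m i g))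
    cell-below : SkewCell ka mu (suc i) (part mu i)
    cell-below = part-antitone mu i ,
                 subst (part mu i <_) (sym (rim-step i (proj₁ (cell⇒inWindow cell)) i<b))
                       (subst (part mu i <_) (+-comm 1 (part mu i)) ≤-refl)

  connected : ∀ i j i′ j′ → SkewCell ka mu i j → SkewCell ka mu i′ j′ → SkewPath ka mu i j i′ j′
  connected i j i′ j′ c c′ = toLast c ++ₚ reversePath c′ (toLast c′)
    where
    toLast : ∀ {i j} → SkewCell ka mu i j → SkewPath ka mu i j b (part mu b)
    toLast {i} {j} cell = pathToLast (b ∸ i) i j (m∸n+n≡m (proj₂ (cell⇒inWindow cell))) cell

  d : ℕ
  d = b ∸ a

  a+d≡b : a + d ≡ b
  a+d≡b = m+[n∸m]≡n a≤b

  a+1+d≡1+b : a + suc d ≡ suc b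
  a+1+d≡1+b = trans (+-suc a d) (cong suc a+d≡b)

  strip-size : t + U b ≡ L a + d
  strip-size = +-cancelʳ-≡ X _ _ (begin
    t + U b + X              ≡⟨ cong (λ u → t + u + X) U-last ⟩
    t + newLast + X          ≡⟨ solve 3 (λ T N X → T :+ N :+ X := N :+ X :+ T) refl t newLast X ⟩
    newLast + X + t          ≡⟨ cong (_+ t) newLast+X ⟩
    target + t               ≡⟨ m∸n+n≡m t≤βa ⟩
    L a + (m ∸ suc a)        ≡⟨ cong (L a +_) m∸1+a ⟩
    L a + (X + d)            ≡⟨ solve 3 (λ A X D → A :+ (X :+ D) := A :+ D :+ X) refl (L a) X d ⟩
    L a + d + X              ∎)
    where
    open ≡-Reasoning
    m∸1+a : m ∸ suc a ≡ X + d
    m∸1+a = trans (∸-suc-shift m a d (subst (_≤ m) (cong suc (sym a+d≡b)) b<m))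
                  (cong (λ i → m ∸ suc i + d) a+d≡b)

  size : sumTo (ℓ ka) (λ i → L i ∸ part mu i) ≡ t
  size = begin
    sumTo (ℓ ka) (λ i → L i ∸ part mu i)               ≡⟨ sumRange-cong 0 (ℓ ka) (λ i _ _ → cong (L i ∸_) (part-mu i)) ⟩
    sumTo (ℓ ka) (λ i → L i ∸ U i)
      ≡⟨ sumTo-window (ℓ ka) a (suc d) _ (subst (_≤ ℓ ka) (sym a+1+d≡1+b) b<ℓ) outside≡0 ⟩
    Σwindow                                            ≡⟨ +-cancelʳ-≡ (U (a + d)) _ _ (trans telescoped (sym size+U)) ⟩
    t                                                  ∎
    where
    open ≡-Reasoning
    Σwindow : ℕ
    Σwindow = sumTo (suc d) (λ k → L (a + k) ∸ U (a + k))
    outside≡0 : ∀ i → i < a ⊎ a + suc d ≤ i → L i ∸ U i ≡ 0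
    outside≡0 i (inj₁ i<a)  = trans (cong (L i ∸_) (U-before i i<a)) (n∸n≡0 (L i))
    outside≡0 i (inj₂ past) = trans (cong (L i ∸_) (U-after i (subst (_≤ i) a+1+d≡1+b past))) (n∸n≡0 (L i))
    telescoped : Σwindow + U (a + d) ≡ L a + d
    telescoped = sumTo-telescope L U a d U≤L (λ k k<d →
      trans (rim-step (a + k) (m≤m+n a k) (subst (a + k <_) a+d≡b (+-monoʳ-< a k<d))) (cong (_+ 1) (part-mu (a + k))))
    size+U : t + U (a + d) ≡ L a + d
    size+U = trans (cong (λ i → t + U i) a+d≡b) strip-size

  strip : RemovesStrip t ka mu
  strip = (λ i → subst (_≤ L i) (sym (part-mu i)) (U≤L i)) , size , no-square , connected

-- The rank formula

removals-preserve-nCount : ∀ t n .{{_ : NonZero t}} la ka → ℓ la ≤ t * n → Star (RemovesStrip t) la ka →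
                           (∀ i → nCount t la (t * n) i ≡ nCount t ka (t * n) i) × ℓ ka ≤ t * n
removals-preserve-nCount t n la .la ℓ≤m ε = (λ i → refl) , ℓ≤m
removals-preserve-nCount t n la ka ℓ≤m (_◅_ {j = mu} strip rest)
  with removals-preserve-nCount t n mu ka (≤-trans (ℓ-mono mu la (proj₁ strip)) ℓ≤m) rest
... | same , ℓka≤m = (λ i → trans (StripRemoval.nCount-preserved t n la mu ℓ≤m strip i) (same i)) , ℓka≤m

core⇒Flush : ∀ t n .{{_ : NonZero t}} ka (ℓ≤m : ℓ ka ≤ t * n) → ¬ (∃ λ mu → RemovesStrip t ka mu) →
             Abacus.Flush t n ka ℓ≤m
core⇒Flush t n ka ℓ≤m no-strip y (j , j<m , βj≡y) t≤y
  with ∃<? (λ j′ → betaEntry ka (t * n) j′ ≡ y ∸ t) (λ j′ → betaEntry ka (t * n) j′ ≟ y ∸ t) (t * n)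
... | yes bead-below = bead-below
... | no no-bead-below = ⊥-elim (no-strip (StripAtBead.mu t n ka ℓ≤m j j<m t≤βj empty ,
                                           StripAtBead.strip t n ka ℓ≤m j j<m t≤βj empty))
  where
  t≤βj : t ≤ betaEntry ka (t * n) j
  t≤βj = subst (t ≤_) (sym βj≡y) t≤y
  empty : ¬ (∃ λ j′ → j′ < t * n × betaEntry ka (t * n) j′ ≡ betaEntry ka (t * n) j ∸ t)
  empty (j′ , j′<m , βj′≡) = no-bead-below (j′ , j′<m , trans βj′≡ (cong (_∸ t) βj≡y))

sumRange-δ-exactlyOne : ∀ lo hi a g → ExactlyOne (a ∈[ lo , hi ⟩) (g ∈[ lo , hi ⟩) →
                        sumRange lo hi (δ a) + sumRange lo hi (δ g) ≡ 1
sumRange-δ-exactlyOne lo hi a g (inj₁ ((lo≤a , a<hi) , g∉)) =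
  trans (cong₂ _+_ (sumRange-δ lo hi a lo≤a a<hi) (sumRange-δ-outside lo hi g g∉)) refl
sumRange-δ-exactlyOne lo hi a g (inj₂ (a∉ , (lo≤g , g<hi))) =
  cong₂ _+_ (sumRange-δ-outside lo hi a a∉) (sumRange-δ lo hi g lo≤g g<hi)

exactlyOne-lowerWindow : ∀ lo H a g → lo ≤ a → lo ≤ g → ExactlyOne (a < H) (g < H) →
                         ExactlyOne (a ∈[ lo , H ⟩) (g ∈[ lo , H ⟩)
exactlyOne-lowerWindow lo H a g lo≤a lo≤g (inj₁ (a<H , g≮H)) = inj₁ ((lo≤a , a<H) , g≮H ∘ proj₂)
exactlyOne-lowerWindow lo H a g lo≤a lo≤g (inj₂ (a≮H , g<H)) = inj₂ (a≮H ∘ proj₂ , (lo≤g , g<H))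

exactlyOne-upperWindow : ∀ H hi a g → a < hi → g < hi → ExactlyOne (a < H) (g < H) →
                         ExactlyOne (a ∈[ H , hi ⟩) (g ∈[ H , hi ⟩)
exactlyOne-upperWindow H hi a g a<hi g<hi (inj₁ (a<H , g≮H)) = inj₂ ((λ a∈ → <⇒≱ a<H (proj₁ a∈)) , (≮⇒≥ g≮H , g<hi))
exactlyOne-upperWindow H hi a g a<hi g<hi (inj₂ (a≮H , g<H)) = inj₁ ((≮⇒≥ a≮H , a<hi) , (λ g∈ → <⇒≱ g<H (proj₁ g∈)))

ceil-half-window : ∀ u → let H = u / 2 + 1 in suc u ≤ H + H × H + H ≤ suc (suc u)
ceil-half-window u = subst (suc u ≤_) (sym H+H) (s≤s (proj₂ (halving-bounds u))) ,
                     subst (_≤ suc (suc u)) (sym H+H) (s≤s (s≤s (proj₁ (halving-bounds u))))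
  where
  H+H : u / 2 + 1 + (u / 2 + 1) ≡ suc (suc (u / 2 + u / 2))
  H+H = solve 1 (λ h → h :+ con 1 :+ (h :+ con 1) := con 2 :+ (h :+ h)) refl (u / 2)

floor-half-window : ∀ u N → suc N ≡ u → N ≤ u / 2 + u / 2 × u / 2 + u / 2 ≤ suc N
floor-half-window u N 1+N≡u = ≤-pred (subst (_≤ suc (u / 2 + u / 2)) (sym 1+N≡u) (proj₂ (halving-bounds u))) ,
                              subst (u / 2 + u / 2 ≤_) (sym 1+N≡u) (proj₁ (halving-bounds u))

module RankFormula (t n : ℕ) .{{_ : NonZero t}} (2≤t : 2 ≤ t) (ka : Partition) (ℓ≤m : ℓ ka ≤ t * n)
                   (no-strip : ¬ (∃ λ mu → RemovesStrip t ka mu)) where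

  open Abacus t n ka ℓ≤m

  flush : Flush
  flush = core⇒Flush t n ka ℓ≤m no-strip

  ∣n-n∣ : ℕ → ℕ
  ∣n-n∣ i = ∣ nCount t ka m i - n ∣

  rk≡sumRange : ∀ lo hi → hi ≤ t →
                (∀ k → k < r → ExactlyOne (α k % t ∈[ lo , hi ⟩) (γ k % t ∈[ lo , hi ⟩)) →
                rk ka ≡ sumRange lo hi ∣n-n∣
  rk≡sumRange lo hi hi≤t exactlyOne = sym (begin
    sumRange lo hi ∣n-n∣
      ≡⟨ sumRange-cong lo hi (λ i _ i<hi → flush⇒∣nCount-n∣ flush i (<-≤-trans i<hi hi≤t)) ⟩
    sumRange lo hi (λ i → countα i + countγ i)
      ≡⟨ sumRange-countα+countγ lo hi ⟩
    sumTo r (λ k → sumRange lo hi (δ (α k % t)) + sumRange lo hi (δ (γ k % t)))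
      ≡⟨ sumRange-cong 0 r (λ k _ k<r → sumRange-δ-exactlyOne lo hi _ _ (exactlyOne k k<r)) ⟩
    sumTo r (λ _ → 1)
      ≡⟨ sumTo-ones r ⟩
    rk ka ∎)
    where open ≡-Reasoning

  module _ (k : ℕ) (k<r : k < r) where

    a g : ℕ
    a = α k % t
    g = γ k % t

    residue-sum : ∀ c → c ≤ 2 → α k + γ k + c ≡ m → a + g + c ≡ t
    residue-sum c c≤2 α+γ+c≡m = residues-sum t n (α k) (γ k) c α+γ+c≡m c≤2 (flush⇒α≢γ flush k k k<r k<r)

    belowCeilHalf : ∀ u → a + g ≡ suc u → ExactlyOne (a < u / 2 + 1) (g < u / 2 + 1)
    belowCeilHalf u a+g≡ = uncurry (exactlyOneBelow a g (u / 2 + 1) (flush⇒α≢γ flush k k k<r k<r))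
      (subst (λ N → N ≤ u / 2 + 1 + (u / 2 + 1) × u / 2 + 1 + (u / 2 + 1) ≤ suc N) (sym a+g≡) (ceil-half-window u))

    belowFloorHalf : ∀ u → suc (a + g) ≡ u → ExactlyOne (a < u / 2) (g < u / 2)
    belowFloorHalf u 1+a+g≡ =
      uncurry (exactlyOneBelow a g (u / 2) (flush⇒α≢γ flush k k k<r k<r)) (floor-half-window u (a + g) 1+a+g≡)

  1+[t∸2]≡t∸1 : suc (t ∸ 2) ≡ t ∸ 1
  1+[t∸2]≡t∸1 = sym (+-∸-assoc 1 2≤t)

  1+[t∸1]≡t : suc (t ∸ 1) ≡ t
  1+[t∸1]≡t = m+[n∸m]≡n (≤-trans (s≤s z≤n) 2≤t)

  half+1≤ : ∀ u → suc u ≤ t → u / 2 + 1 ≤ t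
  half+1≤ u 1+u≤t = ≤-trans (+-monoˡ-≤ 1 (m/n≤m u 2)) (≤-trans (≤-reflexive (+-comm u 1)) 1+u≤t)

  rk-selfConjugate : SelfConjugate ka → rk ka ≡ sumRange 0 ((t ∸ 2) / 2 + 1) ∣n-n∣
  rk-selfConjugate selfConj =
    rk≡sumRange 0 _ (half+1≤ (t ∸ 2) (subst (_≤ t) (sym 1+[t∸2]≡t∸1) (m∸n≤m t 1))) λ k k<r →
      exactlyOne-lowerWindow 0 _ _ _ z≤n z≤n (belowCeilHalf k k<r (t ∸ 2) (a+g≡ k k<r))
    where
    a+g≡ : ∀ k → k < r → α k % t + γ k % t ≡ suc (t ∸ 2)
    a+g≡ k k<r = suc-injective (begin
      suc (α k % t + γ k % t)    ≡⟨ +-comm 1 _ ⟩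
      α k % t + γ k % t + 1      ≡⟨ residue-sum k k<r 1 (s≤s z≤n) α+γ+1≡m ⟩
      t                          ≡⟨ 1+[t∸1]≡t ⟨
      suc (t ∸ 1)                ≡⟨ cong suc 1+[t∸2]≡t∸1 ⟨
      suc (suc (t ∸ 2))          ∎)
      where
      open ≡-Reasoning
      α+γ+1≡m : α k + γ k + 1 ≡ m
      α+γ+1≡m = trans (solve 2 (λ A G → A :+ G :+ con 1 := G :+ (con 1 :+ A)) refl (α k) (γ k))
                      (trans (cong (λ b → γ k + suc (b ∸ suc k)) (sym (selfConj k))) (γ+suc-frobβ≡m k k<r))

  rk-orthogonal : Orthogonal ka → rk ka ≡ sumRange 1 ((t ∸ 1) / 2 + 1) ∣n-n∣
  rk-orthogonal orth = rk≡sumRange 1 _ (half+1≤ (t ∸ 1) (≤-reflexive 1+[t∸1]≡t)) λ k k<r →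
    exactlyOne-lowerWindow 1 _ _ _ (nonzero (a+g≡ k k<r) (m%n<n (γ k) t))
                                   (nonzero (trans (+-comm (γ k % t) (α k % t)) (a+g≡ k k<r)) (m%n<n (α k) t))
                                   (belowCeilHalf k k<r (t ∸ 1) (a+g≡ k k<r))
    where
    a+g≡ : ∀ k → k < r → α k % t + γ k % t ≡ suc (t ∸ 1)
    a+g≡ k k<r = trans (sym (+-identityʳ _)) (trans (residue-sum k k<r 0 z≤n α+γ+0≡m) (sym 1+[t∸1]≡t))
      where
      α+γ+0≡m : α k + γ k + 0 ≡ m
      α+γ+0≡m = trans (+-identityʳ _) (trans (+-comm (α k) (γ k))
                      (trans (cong (γ k +_) (trans (orth k k<r) (+-comm _ 1))) (γ+suc-frobβ≡m k k<r)))
    nonzero : ∀ {x y} → x + y ≡ suc (t ∸ 1) → y < t → 1 ≤ x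
    nonzero {zero}  y≡ y<t = ⊥-elim (<-irrefl (trans y≡ 1+[t∸1]≡t) y<t)
    nonzero {suc x} _  _   = s≤s z≤n

  rk-symplectic : Symplectic ka →
                  rk ka ≡ sumRange 0 ((t ∸ 1) / 2) ∣n-n∣ × rk ka ≡ sumRange ((t ∸ 1) / 2) (t ∸ 1) ∣n-n∣
  rk-symplectic sympl =
    rk≡sumRange 0 _ (≤-trans (m/n≤m (t ∸ 1) 2) (m∸n≤m t 1))
                (λ k k<r → exactlyOne-lowerWindow 0 _ _ _ z≤n z≤n (below k k<r)) ,
    rk≡sumRange _ (t ∸ 1) (m∸n≤m t 1)
                (λ k k<r → exactlyOne-upperWindow _ (t ∸ 1) _ _
                             (subst (α k % t <_) (1+a+g≡ k k<r) (s≤s (m≤m+n _ _)))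
                             (subst (γ k % t <_) (1+a+g≡ k k<r) (s≤s (m≤n+m _ _)))
                             (below k k<r))
    where
    1+a+g≡ : ∀ k → k < r → suc (α k % t + γ k % t) ≡ t ∸ 1
    1+a+g≡ k k<r = cong (_∸ 1) (trans (+-comm 2 _) (residue-sum k k<r 2 ≤-refl α+γ+2≡m))
      where
      α+γ+2≡m : α k + γ k + 2 ≡ m
      α+γ+2≡m = trans (solve 2 (λ A G → A :+ G :+ con 2 := G :+ (con 1 :+ (A :+ con 1))) refl (α k) (γ k))
                      (trans (cong (λ b → γ k + suc b) (sym (sympl k k<r))) (γ+suc-frobβ≡m k k<r))
    below : ∀ k → k < r → ExactlyOne (α k % t < (t ∸ 1) / 2) (γ k % t < (t ∸ 1) / 2)
    below k k<r = belowFloorHalf k k<r (t ∸ 1) (1+a+g≡ k k<r)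

lemma3p13 : (t n : ℕ) → .{{_ : NonZero t}} → (la : Partition) → 2 ≤ t → 1 ≤ n → ℓ la ≤ t * n →
  (ka : Partition) → IsTCoreOf t la ka →
  ((Symplectic ka →
      (rk ka ≡ sumRange 0 ((t ∸ 1) / 2) (λ i → ∣ nCount t la (t * n) i - n ∣)) ×
      (rk ka ≡ sumRange ((t ∸ 1) / 2) (t ∸ 1) (λ i → ∣ nCount t la (t * n) i - n ∣))) ×
   (Orthogonal ka →
      rk ka ≡ sumRange 1 ((t ∸ 1) / 2 + 1) (λ i → ∣ nCount t la (t * n) i - n ∣)) ×
   (SelfConjugate ka →
      rk ka ≡ sumRange 0 ((t ∸ 2) / 2 + 1) (λ i → ∣ nCount t la (t * n) i - n ∣)))
lemma3p13 t n la 2≤t _ ℓ≤m ka (removals , no-strip) =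
  (λ sympl → map (fromCore 0 ((t ∸ 1) / 2)) (fromCore ((t ∸ 1) / 2) (t ∸ 1)) (rk-symplectic sympl)) ,
  fromCore 1 ((t ∸ 1) / 2 + 1) ∘ rk-orthogonal ,
  fromCore 0 ((t ∸ 2) / 2 + 1) ∘ rk-selfConjugate
  where
  preserved : (∀ i → nCount t la (t * n) i ≡ nCount t ka (t * n) i) × ℓ ka ≤ t * n
  preserved = removals-preserve-nCount t n la ka ℓ≤m removals
  open RankFormula t n 2≤t ka (proj₂ preserved) no-strip
  fromCore : ∀ lo hi → rk ka ≡ sumRange lo hi ∣n-n∣ → rk ka ≡ sumRange lo hi (λ i → ∣ nCount t la (t * n) i - n ∣)
  fromCore lo hi rk≡ = trans rk≡ (sumRange-cong lo hi (λ i _ _ → cong (λ c → ∣ c - n ∣) (sym (proj₁ preserved i))))
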